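{- Let $\mathbf{k}$ be a commutative unitary ring. The $\mathbf{k}$-submodule $\overline{\mathrm{LWCQSym}}$ of $\mathbf{k}[[x_0,x_1,x_2,\ldots]]$ spanned by the $\overline{M}_\alpha$, $\alpha\in\mathbb{N}^k\times\mathbb{P}$, $k\geq 0$, is closed under multiplication, the $\mathbf{k}$-linear operator $P_Q:\overline{\mathrm{LWCQSym}}\to\overline{\mathrm{LWCQSym}}$ defined by $P_Q(\overline{M}_\alpha)=\overline{M}_{(0,\alpha)}$ is a Rota–Baxter operator of weight $1$, and $(\overline{\mathrm{LWCQSym}},P_Q)$ is (isomorphic to) the free commutative nonunitary Rota–Baxter algebra of weight $1$ on one generator.
   Context: $x_0,x_1,\ldots$ are commuting variables. For a finite sequence $\alpha'=(\alpha_1,\ldots,\alpha_k)$ of nonnegative integers, $M_{\alpha'}=\sum_{1\leq n_1<\cdots<n_k}x_{n_1}^{\alpha_1}\cdots x_{n_k}^{\alpha_k}$ with $M_{()}=1$. For $\alpha=(\alpha_0,\alpha_1,\ldots,\alpha_k)\in\mathbb{N}^k\times\mathbb{P}$, $\overline{M}_\alpha=x_0^{\alpha_0}M_{(\alpha_1,\ldots,\alpha_k)}$ (so $\overline{M}_{(0,\alpha)}=M_\alpha$). A Rota–Baxter operator of weight $1$ on a (possibly nonunitary) commutative $\mathbf{k}$-algebra $R$ is a $\mathbf{k}$-linear map $P:R\to R$ with $P(x)P(y)=P(xP(y))+P(P(x)y)+P(xy)$ for all $x,y\in R$. A free commutative nonunitary Rota–Baxter algebra of weight 1 on one generator $x$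 is a commutative nonunitary Rota–Baxter algebra $(F,P_F)$ of weight 1 with an element $x\in F$ such that for every commutative nonunitary Rota–Baxter algebra $(R,P)$ of weight 1 and every $r\in R$ there is a unique Rota–Baxter algebra homomorphism $F\to R$ (algebra homomorphism commuting with the operators) sending $x$ to $r$. -}

module Defs where

open import Level using (Level; _⊔_; suc; Setω)
open import Data.Nat as ℕ using (ℕ; zero; _∸_; _≟_)
open import Data.Bool using (Bool; true; false; if_then_else_; _∧_)
open import Data.List using (List; []; _∷_; [_]; _++_; map; concatMap; upTo; foldr)
open import Data.Product using (Σ; _×_; _,_; proj₁; proj₂)
open import Relation.Nullary using (does)
open import Algebra.Bundles using (CommutativeRing)
open import Algebra.Module.Bundles using (Module)

-- Monomials in x_0, x_1, x_2, ... : a list (e_0, e_1, ..., e_m) stands for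
-- x_0^e_0 x_1^e_1 ... x_m^e_m (trailing zeros are harmless).

Monomial : Set
Monomial = List ℕ

headExp : Monomial → ℕ
headExp []      = 0
headExp (e ∷ _) = e

tailExp : Monomial → Monomial
tailExp []       = []
tailExp (_ ∷ es) = es

allZero : List ℕ → Bool
allZero []       = true
allZero (e ∷ es) = does (e ≟ 0) ∧ allZero es

-- embed as bs = number of strictly increasing sequences of positions
-- 1 ≤ n_1 < ... < n_k (positions counted in bs, continued by zeros) such that
-- x_{n_1}^{a_1} ... x_{n_k}^{a_k} is exactly the monomial with exponents bs,
-- i.e. the coefficient of x^bs in M_{(a_1,...,a_k)} (for a_k > 0).
embed : List ℕ → List ℕ → ℕ
embed []       bs       = if allZero bs then 1 else 0
embed (a ∷ as) []       = 0
embed (a ∷ as) (b ∷ bs) =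
  (if does (a ≟ b) then embed as bs else 0)
  ℕ.+ (if does (b ≟ 0) then embed (a ∷ as) bs else 0)

splits : Monomial → List (Monomial × Monomial)
splits []       = [ ([] , []) ]
splits (b ∷ bs) =
  concatMap (λ i → map (λ p → (i ∷ proj₁ p , (b ∸ i) ∷ proj₂ p)) (splits bs))
            (upTo (ℕ.suc b))

-- Indices α = (α_0, ..., α_{k-1}, α_k) ∈ ℕ^k × ℙ  (k ≥ 0):
-- front = (α_0,...,α_{k-1}), and α_k = suc last (positive).

record Idx : Set where
  constructor idx
  field
    front : List ℕ
    last  : ℕ

word : Idx → List ℕ
word (idx f l) = f ++ [ ℕ.suc l ]

cons0 : Idx → Idx
cons0 (idx f l) = idx (0 ∷ f) l

module _ {c ℓ} (k : CommutativeRing c ℓ) where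
  open CommutativeRing k

  natK : ℕ → Carrier
  natK zero      = 0#
  natK (ℕ.suc n) = 1# + natK n

  sumK : List Carrier → Carrier
  sumK = foldr _+_ 0#

  Series : Set c
  Series = Monomial → Carrier

  _≈ₛ_ : Series → Series → Set ℓ
  f ≈ₛ g = ∀ β → f β ≈ g β

  0ₛ : Series
  0ₛ _ = 0#

  _+ₛ_ : Series → Series → Series
  (f +ₛ g) β = f β + g β

  _·ₛ_ : Carrier → Series → Series
  (r ·ₛ f) β = r * f β

  _*ₛ_ : Series → Series → Series
  (f *ₛ g) β = sumK (map (λ p → f (proj₁ p) * g (proj₂ p)) (splits β))

  -- \bar M_α = x_0^{α_0} M_{(α_1,...,α_k)}
  Mbar : Idx → Series
  Mbar α β with word α
  ... | []       = 0#   -- impossible: word α is nonempty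
  ... | a₀ ∷ as  =
    if does (headExp β ≟ a₀) then natK (embed as (tailExp β)) else 0#

  data InSpan : Series → Set (c ⊔ ℓ) where
    basis : ∀ α → InSpan (Mbar α)
    zer   : InSpan 0ₛ
    add   : ∀ {f g} → InSpan f → InSpan g → InSpan (f +ₛ g)
    scale : ∀ r {f} → InSpan f → InSpan (r ·ₛ f)
    resp  : ∀ {f g} → f ≈ₛ g → InSpan f → InSpan g

  Sub : Set (c ⊔ ℓ)
  Sub = Σ Series InSpan

  _≈S_ : Sub → Sub → Set ℓ
  x ≈S y = proj₁ x ≈ₛ proj₁ y

  _⊕_ : Sub → Sub → Sub
  (f , p) ⊕ (g , q) = (f +ₛ g , add p q)

  _⊙_ : Carrier → Sub → Sub
  r ⊙ (f , p) = (r ·ₛ f , scale r p)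

  MulClosed : Set (c ⊔ ℓ)
  MulClosed = ∀ {f g} → InSpan f → InSpan g → InSpan (f *ₛ g)

  module _ (mc : MulClosed) where
    _⊗_ : Sub → Sub → Sub
    (f , p) ⊗ (g , q) = (f *ₛ g , mc p q)

  IsLinearSub : (Sub → Sub) → Set (c ⊔ ℓ)
  IsLinearSub P =
    (∀ x y → x ≈S y → P x ≈S P y)
    × (∀ x y → P (x ⊕ y) ≈S (P x ⊕ P y))
    × (∀ r x → P (r ⊙ x) ≈S (r ⊙ P x))

  IsRotaBaxterSub : MulClosed → (Sub → Sub) → Set (c ⊔ ℓ)
  IsRotaBaxterSub mc P = ∀ x y →
    _⊗_ mc (P x) (P y)
      ≈S ((P (_⊗_ mc x (P y)) ⊕ P (_⊗_ mc (P x) y)) ⊕ P (_⊗_ mc x y))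

  record RBAlgebra (m ℓm : Level) : Set (c ⊔ ℓ ⊔ suc (m ⊔ ℓm)) where
    field
      module′ : Module k m ℓm
    open Module module′ public
    field
      _·_      : Carrierᴹ → Carrierᴹ → Carrierᴹ
      ·-cong   : ∀ {x x′ y y′} → x ≈ᴹ x′ → y ≈ᴹ y′ → (x · y) ≈ᴹ (x′ · y′)
      ·-assoc  : ∀ x y z → ((x · y) · z) ≈ᴹ (x · (y · z))
      ·-comm   : ∀ x y → (x · y) ≈ᴹ (y · x)
      ·-distribʳ : ∀ x y z → ((y +ᴹ z) · x) ≈ᴹ ((y · x) +ᴹ (z · x))
      ·-distribˡ : ∀ x y z → (x · (y +ᴹ z)) ≈ᴹ ((x · y) +ᴹ (x · z))
      *ₗ-·     : ∀ r x y → ((r *ₗ x) · y) ≈ᴹ (r *ₗ (x · y))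
      ·-*ₗ     : ∀ r x y → (x · (r *ₗ y)) ≈ᴹ (r *ₗ (x · y))
      P        : Carrierᴹ → Carrierᴹ
      P-cong   : ∀ {x y} → x ≈ᴹ y → P x ≈ᴹ P y
      P-+      : ∀ x y → P (x +ᴹ y) ≈ᴹ (P x +ᴹ P y)
      P-*ₗ     : ∀ r x → P (r *ₗ x) ≈ᴹ (r *ₗ P x)
      P-RB     : ∀ x y →
        (P x · P y) ≈ᴹ ((P (x · P y) +ᴹ P (P x · y)) +ᴹ P (x · y))

  IsRBHom : (mc : MulClosed) (PQ : Sub → Sub) {m ℓm : Level}
            (R : RBAlgebra m ℓm) → (Sub → RBAlgebra.Carrierᴹ R) → Set (c ⊔ ℓ ⊔ ℓm)
  IsRBHom mc PQ R h =
    (∀ x y → x ≈S y → h x ≈ᴹ h y)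
    × (∀ x y → h (x ⊕ y) ≈ᴹ (h x +ᴹ h y))
    × (∀ r x → h (r ⊙ x) ≈ᴹ (r *ₗ h x))
    × (∀ x y → h (_⊗_ mc x y) ≈ᴹ (h x · h y))
    × (∀ x → h (PQ x) ≈ᴹ P (h x))
    where open RBAlgebra R

  IsFreeOn : MulClosed → (Sub → Sub) → Sub → (m ℓm : Level) → Set (c ⊔ ℓ ⊔ suc (m ⊔ ℓm))
  IsFreeOn mc PQ gen m ℓm =
    (R : RBAlgebra m ℓm) (r : RBAlgebra.Carrierᴹ R) →
    Σ (Sub → RBAlgebra.Carrierᴹ R) λ h →
      IsRBHom mc PQ R h
      × RBAlgebra._≈ᴹ_ R (h gen) r
      × (∀ h′ → IsRBHom mc PQ R h′ → RBAlgebra._≈ᴹ_ R (h′ gen) r →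
           ∀ x → RBAlgebra._≈ᴹ_ R (h′ x) (h x))

  record Theorem3p9 : Setω where
    field
      mul-closed : MulClosed
      PQ         : Sub → Sub
      PQ-linear  : IsLinearSub PQ
      PQ-basis   : ∀ α → proj₁ (PQ (Mbar α , basis α)) ≈ₛ Mbar (cons0 α)
      PQ-RB      : IsRotaBaxterSub mul-closed PQ
      generator  : Sub
      free       : ∀ (m ℓm : Level) → IsFreeOn mul-closed PQ generator m ℓm

-- Write Pˢ f (x₀, x₁, …) = ∑_{n ≥ 1} f (x_n, x_{n+1}, …). On coefficients Pˢ satisfies a one-step
-- recursion, from which the weight-1 Rota–Baxter identity on all of k[[x₀, x₁, …]] follows by
-- induction on the monomial. Since M̄_(1+l) = x₀^{1+l} and M̄_(a,α) = x₀^a · Pˢ (M̄_α), the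
-- Rota–Baxter identity expands a product M̄_α · M̄_β into a sum of M̄_γ (the quasi-shuffle
-- recursion), so the span is closed under products and under Pˢ.
--
-- Given a commutative Rota–Baxter algebra (R, P) and r ∈ R, send M̄_α to the word
-- r^{α₀} P (r^{α₁} P (⋯ P (r^{αₖ}))). The same recursion holds in R, so the linear extension of
-- this map respects products and P. It is well defined because the M̄_α are linearly
-- independent: M̄_α has coefficient 1 at x^α and 0 at every other x^β with β no longer than α, so
-- in a vanishing combination the coefficient of an index of least length is 0. It is unique
-- because every M̄_α arises from x₀ = M̄_(1) by multiplications by x₀ and applications of Pˢ.

module Submission where

open import Defs
open import Level using (Level)
open import Algebra.Bundles using (CommutativeRing; CommutativeMonoid)
open import Algebra.Module.Bundles using (Module)
import Algebra.Module.Properties as ModuleProperties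
import Algebra.Properties.CommutativeSemigroup as CommSemigroupProperties
import Algebra.Properties.Ring as RingProperties
import Algebra.Solver.CommutativeMonoid as CommMonoidSolver
open import Data.Bool using (true; false; if_then_else_)
open import Data.Fin using (#_)
open import Data.List using (List; []; _∷_; [_]; _++_; map; concatMap; filter; upTo; applyUpTo; length)
open import Data.List.Relation.Unary.All using (All; []; _∷_)
open import Data.List.Relation.Unary.Any as Any using (Any; here; there)
open import Data.List.Membership.Propositional using (_∈_)
import Data.List.Extrema as Extrema
import Data.Sum as Sum
import Data.Bool.Properties as Bool
import Data.List.Properties as List
open import Data.Nat as ℕ using (ℕ; zero; suc; _∸_; _≟_; _<_; _≤_; s≤s; z≤n)
import Data.Nat.Properties as ℕ
open import Data.Product using (Σ; _×_; _,_; proj₁; proj₂)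
open import Data.Vec using () renaming (_∷_ to _∷ᵥ_; [] to []ᵥ)
open import Data.Empty using (⊥-elim)
open import Function using (_∘_)
open import Relation.Binary.Bundles using (Setoid)
import Relation.Binary.Reasoning.Setoid as SetoidReasoning
open import Relation.Binary.PropositionalEquality as ≡ using (_≡_; _≢_; refl)
open import Relation.Binary.Definitions using (DecidableEquality)
open import Relation.Nullary using (does; yes; no; ¬_; ¬?; _×-dec_)
import Relation.Nullary.Decidable as Dec
open import Relation.Nullary.Decidable using (dec-true; dec-false)

leastBy : ∀ {a} {A : Set a} (key : A → ℕ) x xs →
          Σ A λ m → m ∈ x ∷ xs × All (λ y → key m ≤ key y) (x ∷ xs)
leastBy {A = A} key x xs =
  m , Sum.[ here , there ]′ (argmin-sel key x xs) ,
  f[argmin]≤f[⊤] {f = key} x xs ∷ f[argmin]≤f[xs] {f = key} x xs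
  where
  open Extrema ℕ.≤-totalOrder
  m : A
  m = argmin key x xs

module LWCQSym {c ℓ : Level} (k : CommutativeRing c ℓ) where
  open CommutativeRing k renaming (refl to ≈-refl; sym to ≈-sym; trans to ≈-trans)

  ∑ : List Carrier → Carrier
  ∑ = sumK k

  ∑-++ : ∀ xs ys → ∑ (xs ++ ys) ≈ ∑ xs + ∑ ys
  ∑-++ []       ys = ≈-sym (+-identityˡ _)
  ∑-++ (x ∷ xs) ys = ≈-trans (+-congˡ (∑-++ xs ys)) (≈-sym (+-assoc _ _ _))

  +-interchange : ∀ a b c d → (a + b) + (c + d) ≈ (a + c) + (b + d)
  +-interchange = CommSemigroupProperties.interchange +-commutativeSemigroup

  module _ {a} {A : Set a} where

    ∑-map-++ : ∀ (f : A → Carrier) xs ys → ∑ (map f (xs ++ ys)) ≈ ∑ (map f xs) + ∑ (map f ys)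
    ∑-map-++ f xs ys = ≈-trans (reflexive (≡.cong ∑ (List.map-++ f xs ys))) (∑-++ (map f xs) (map f ys))

    ∑-cong : ∀ (xs : List A) {f g : A → Carrier} → (∀ x → f x ≈ g x) →
             ∑ (map f xs) ≈ ∑ (map g xs)
    ∑-cong []       f≈g = ≈-refl
    ∑-cong (x ∷ xs) f≈g = +-cong (f≈g x) (∑-cong xs f≈g)

    ∑-+ : ∀ (xs : List A) (f g : A → Carrier) →
          ∑ (map (λ x → f x + g x) xs) ≈ ∑ (map f xs) + ∑ (map g xs)
    ∑-+ []       f g = ≈-sym (+-identityˡ 0#)
    ∑-+ (x ∷ xs) f g = ≈-trans (+-congˡ (∑-+ xs f g)) (+-interchange _ _ _ _)

    ∑-*ˡ : ∀ (xs : List A) r (f : A → Carrier) → ∑ (map (λ x → r * f x) xs) ≈ r * ∑ (map f xs)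
    ∑-*ˡ []       r f = ≈-sym (zeroʳ r)
    ∑-*ˡ (x ∷ xs) r f = ≈-trans (+-congˡ (∑-*ˡ xs r f)) (≈-sym (distribˡ r _ _))

    ∑-zero : ∀ (xs : List A) {f : A → Carrier} → (∀ x → f x ≈ 0#) → ∑ (map f xs) ≈ 0#
    ∑-zero []       f≈0 = ≈-refl
    ∑-zero (x ∷ xs) f≈0 = ≈-trans (+-cong (f≈0 x) (∑-zero xs f≈0)) (+-identityˡ 0#)

  ∑-concatMap : ∀ {a b} {A : Set a} {B : Set b} (xs : List A) (g : A → List B) (f : B → Carrier) →
                ∑ (map f (concatMap g xs)) ≈ ∑ (map (λ x → ∑ (map f (g x))) xs)
  ∑-concatMap []       g f = ≈-refl
  ∑-concatMap (x ∷ xs) g f =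
    ≈-trans (∑-map-++ f (g x) (concatMap g xs)) (+-congˡ (∑-concatMap xs g f))

  ∑< : ℕ → (ℕ → Carrier) → Carrier
  ∑< n f = ∑ (applyUpTo f n)

  syntax ∑< n (λ i → e) = ∑[ i < n ] e

  ∑<-zero : ∀ n (f : ℕ → Carrier) → (∀ i → i < n → f i ≈ 0#) → ∑[ i < n ] f i ≈ 0#
  ∑<-zero zero    f f≈0 = ≈-refl
  ∑<-zero (suc n) f f≈0 =
    ≈-trans (+-cong (f≈0 0 (s≤s z≤n)) (∑<-zero n (f ∘ suc) (λ i i<n → f≈0 (suc i) (s≤s i<n))))
            (+-identityˡ 0#)

  ∑<-single : ∀ n (f : ℕ → Carrier) j → j < n → (∀ i → i < n → i ≢ j → f i ≈ 0#) →
              ∑[ i < n ] f i ≈ f j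
  ∑<-single (suc n) f zero    _         f≈0 =
    ≈-trans (+-congˡ (∑<-zero n (f ∘ suc) (λ i i<n → f≈0 (suc i) (s≤s i<n) (λ ()))))
            (+-identityʳ _)
  ∑<-single (suc n) f (suc j) (s≤s j<n) f≈0 =
    ≈-trans (+-congʳ (f≈0 0 (s≤s z≤n) (λ ())))
      (≈-trans (+-identityˡ _)
        (∑<-single n (f ∘ suc) j j<n
          (λ i i<n i≢j → f≈0 (suc i) (s≤s i<n) (i≢j ∘ ℕ.suc-injective))))

  infix  4 _≈ˢ_
  infixl 6 _+ˢ_
  infixl 7 _*ˢ_ _·ˢ_
  infixl 8 _↓_

  _≈ˢ_ : Series k → Series k → Set ℓ
  _≈ˢ_ = _≈ₛ_ k

  _+ˢ_ : Series k → Series k → Series k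
  _+ˢ_ = _+ₛ_ k

  _*ˢ_ : Series k → Series k → Series k
  _*ˢ_ = _*ₛ_ k

  _·ˢ_ : Carrier → Series k → Series k
  _·ˢ_ = _·ₛ_ k

  0ˢ : Series k
  0ˢ = 0ₛ k

  seriesSetoid : Setoid c ℓ
  seriesSetoid = record
    { Carrier       = Series k
    ; _≈_           = _≈ˢ_
    ; isEquivalence = record
      { refl  = λ β → ≈-refl
      ; sym   = λ f≈g β → ≈-sym (f≈g β)
      ; trans = λ f≈g g≈h β → ≈-trans (f≈g β) (g≈h β)
      }
    }

  open Setoid seriesSetoid public using ()
    renaming (refl to ≈ˢ-refl; sym to ≈ˢ-sym; trans to ≈ˢ-trans)

  +ˢ-cong : ∀ {f f′ g g′} → f ≈ˢ f′ → g ≈ˢ g′ → f +ˢ g ≈ˢ f′ +ˢ g′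
  +ˢ-cong f≈f′ g≈g′ β = +-cong (f≈f′ β) (g≈g′ β)

  -- f ↓ i is the coefficient of x₀^i in f, with x₁, x₂, … renamed x₀, x₁, …
  _↓_ : Series k → ℕ → Series k
  (f ↓ i) β = f (i ∷ β)

  *ˢ-∷ : ∀ f g b β → (f *ˢ g) (b ∷ β) ≈ ∑[ i < suc b ] ((f ↓ i) *ˢ (g ↓ (b ∸ i))) β
  *ˢ-∷ f g b β = begin
    (f *ˢ g) (b ∷ β)                                      ≈⟨ ∑-concatMap (upTo (suc b)) terms φ ⟩
    ∑ (map (λ i → ∑ (map φ (terms i))) (upTo (suc b)))
      ≈⟨ ∑-cong (upTo (suc b)) (λ i → reflexive (≡.cong ∑ (≡.sym (List.map-∘ (splits β))))) ⟩
    ∑ (map (λ i → ((f ↓ i) *ˢ (g ↓ (b ∸ i))) β) (upTo (suc b)))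
      ≡⟨ ≡.cong ∑ (List.map-applyUpTo (λ i → i) _ (suc b)) ⟩
    ∑[ i < suc b ] ((f ↓ i) *ˢ (g ↓ (b ∸ i))) β           ∎
    where
    open SetoidReasoning setoid
    φ : Monomial × Monomial → Carrier
    φ p = f (proj₁ p) * g (proj₂ p)
    terms : ℕ → List (Monomial × Monomial)
    terms i = map (λ p → (i ∷ proj₁ p , (b ∸ i) ∷ proj₂ p)) (splits β)

  *ˢ-cong : ∀ {f f′ g g′} → f ≈ˢ f′ → g ≈ˢ g′ → f *ˢ g ≈ˢ f′ *ˢ g′
  *ˢ-cong f≈f′ g≈g′ β = ∑-cong (splits β) (λ p → *-cong (f≈f′ (proj₁ p)) (g≈g′ (proj₂ p)))

  *ˢ-zeroˡ : ∀ {f} g → f ≈ˢ 0ˢ → f *ˢ g ≈ˢ 0ˢ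
  *ˢ-zeroˡ g f≈0 β = ∑-zero (splits β) (λ p → ≈-trans (*-congʳ (f≈0 (proj₁ p))) (zeroˡ _))

  *ˢ-zeroʳ : ∀ f {g} → g ≈ˢ 0ˢ → f *ˢ g ≈ˢ 0ˢ
  *ˢ-zeroʳ f g≈0 β = ∑-zero (splits β) (λ p → ≈-trans (*-congˡ (g≈0 (proj₂ p))) (zeroʳ _))

  *ˢ-distribʳ : ∀ h f g → (f +ˢ g) *ˢ h ≈ˢ f *ˢ h +ˢ g *ˢ h
  *ˢ-distribʳ h f g β = ≈-trans (∑-cong (splits β) (λ p → distribʳ _ _ _)) (∑-+ (splits β) _ _)

  *ˢ-distribˡ : ∀ f g h → f *ˢ (g +ˢ h) ≈ˢ f *ˢ g +ˢ f *ˢ h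
  *ˢ-distribˡ f g h β = ≈-trans (∑-cong (splits β) (λ p → distribˡ _ _ _)) (∑-+ (splits β) _ _)

  ·ˢ-*ˢ-·ˢ : ∀ a b f g → (a ·ˢ f) *ˢ (b ·ˢ g) ≈ˢ (a * b) ·ˢ (f *ˢ g)
  ·ˢ-*ˢ-·ˢ a b f g β =
    ≈-trans (∑-cong (splits β) (λ p → *-interchange a (f (proj₁ p)) b (g (proj₂ p))))
            (∑-*ˡ (splits β) (a * b) _)
    where open CommSemigroupProperties *-commutativeSemigroup using () renaming (interchange to *-interchange)

  -- The Rota–Baxter operator on power series

  -- Pˢ f (x₀, x₁, …) = ∑_{n ≥ 1} f (x_n, x_{n+1}, …)
  Pˢ : Series k → Series k
  Pˢ f []          = 0#
  Pˢ f (zero ∷ β)  = f β + Pˢ f β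
  Pˢ f (suc _ ∷ _) = 0#

  Pˢ-cong : ∀ {f g} → f ≈ˢ g → Pˢ f ≈ˢ Pˢ g
  Pˢ-cong f≈g []          = ≈-refl
  Pˢ-cong f≈g (zero ∷ β)  = +-cong (f≈g β) (Pˢ-cong f≈g β)
  Pˢ-cong f≈g (suc _ ∷ _) = ≈-refl

  Pˢ-+ : ∀ f g → Pˢ (f +ˢ g) ≈ˢ Pˢ f +ˢ Pˢ g
  Pˢ-+ f g []          = ≈-sym (+-identityˡ 0#)
  Pˢ-+ f g (zero ∷ β)  = ≈-trans (+-congˡ (Pˢ-+ f g β)) (+-interchange _ _ _ _)
  Pˢ-+ f g (suc _ ∷ _) = ≈-sym (+-identityˡ 0#)

  Pˢ-· : ∀ a f → Pˢ (a ·ˢ f) ≈ˢ a ·ˢ Pˢ f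
  Pˢ-· a f []          = ≈-sym (zeroʳ a)
  Pˢ-· a f (zero ∷ β)  = ≈-trans (+-congˡ (Pˢ-· a f β)) (≈-sym (distribˡ a _ _))
  Pˢ-· a f (suc _ ∷ _) = ≈-sym (zeroʳ a)

  Pˢ-zero : ∀ {f} → f ≈ˢ 0ˢ → Pˢ f ≈ˢ 0ˢ
  Pˢ-zero f≈0 []          = ≈-refl
  Pˢ-zero f≈0 (zero ∷ β)  = ≈-trans (+-cong (f≈0 β) (Pˢ-zero f≈0 β)) (+-identityˡ 0#)
  Pˢ-zero f≈0 (suc _ ∷ _) = ≈-refl

  0+0+0≈0 : 0# + 0# + 0# ≈ 0#
  0+0+0≈0 = ≈-trans (+-congʳ (+-identityˡ 0#)) (+-identityˡ 0#)

  Pˢ-rotaBaxter : ∀ f g → Pˢ f *ˢ Pˢ g ≈ˢ Pˢ (f *ˢ Pˢ g) +ˢ Pˢ (Pˢ f *ˢ g) +ˢ Pˢ (f *ˢ g)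
  Pˢ-rotaBaxter f g [] =
    ≈-trans (+-identityʳ _) (≈-trans (zeroˡ _) (≈-sym 0+0+0≈0))
  Pˢ-rotaBaxter f g (zero ∷ β) = begin
    (Pˢ f *ˢ Pˢ g) (0 ∷ β)                      ≈⟨ *ˢ-∷ (Pˢ f) (Pˢ g) 0 β ⟩
    ((f +ˢ Pˢ f) *ˢ (g +ˢ Pˢ g)) β + 0#          ≈⟨ +-identityʳ _ ⟩
    ((f +ˢ Pˢ f) *ˢ (g +ˢ Pˢ g)) β               ≈⟨ *ˢ-distribʳ (g +ˢ Pˢ g) f (Pˢ f) β ⟩
    (f *ˢ (g +ˢ Pˢ g)) β + (Pˢ f *ˢ (g +ˢ Pˢ g)) β
      ≈⟨ +-cong (*ˢ-distribˡ f g (Pˢ g) β) (*ˢ-distribˡ (Pˢ f) g (Pˢ g) β) ⟩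
    (fg + fPg) + (Pfg + (Pˢ f *ˢ Pˢ g) β)        ≈⟨ +-congˡ (+-congˡ (Pˢ-rotaBaxter f g β)) ⟩
    (fg + fPg) + (Pfg + (P[fPg] + P[Pfg] + P[fg]))
      ≈⟨ rearrange fPg Pfg fg P[fPg] P[Pfg] P[fg] ⟩
    (fPg + P[fPg]) + (Pfg + P[Pfg]) + (fg + P[fg]) ∎
    where
    open SetoidReasoning setoid
    fPg Pfg fg P[fPg] P[Pfg] P[fg] : Carrier
    fPg = (f *ˢ Pˢ g) β
    Pfg = (Pˢ f *ˢ g) β
    fg  = (f *ˢ g) β
    P[fPg] = Pˢ (f *ˢ Pˢ g) β
    P[Pfg] = Pˢ (Pˢ f *ˢ g) β
    P[fg]  = Pˢ (f *ˢ g) β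
    rearrange : ∀ x y z u v w → (z + x) + (y + (u + v + w)) ≈ (x + u) + (y + v) + (z + w)
    rearrange x y z u v w =
      prove 6 ((Z ⊞ X) ⊞ (Y ⊞ ((U ⊞ V) ⊞ W))) (((X ⊞ U) ⊞ (Y ⊞ V)) ⊞ (Z ⊞ W))
              (x ∷ᵥ y ∷ᵥ z ∷ᵥ u ∷ᵥ v ∷ᵥ w ∷ᵥ []ᵥ)
      where
      open CommMonoidSolver +-commutativeMonoid using (Expr; prove; var) renaming (_⊕_ to _⊞_)
      X Y Z U V W : Expr 6
      X = var (# 0); Y = var (# 1); Z = var (# 2); U = var (# 3); V = var (# 4); W = var (# 5)
  Pˢ-rotaBaxter f g (suc b ∷ β) =
    ≈-trans (*ˢ-∷ (Pˢ f) (Pˢ g) (suc b) β) (≈-trans (∑<-zero (suc (suc b)) _ vanish) (≈-sym 0+0+0≈0))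
    where
    vanish : ∀ i → i < suc (suc b) → ((Pˢ f ↓ i) *ˢ (Pˢ g ↓ (suc b ∸ i))) β ≈ 0#
    vanish zero    _ = *ˢ-zeroʳ (Pˢ f ↓ 0) (λ _ → ≈-refl) β
    vanish (suc i) _ = *ˢ-zeroˡ (Pˢ g ↓ (suc b ∸ suc i)) (λ _ → ≈-refl) β

  if-then-cong : ∀ b {x y} → x ≈ y → (if b then x else 0#) ≈ (if b then y else 0#)
  if-then-cong true  x≈y = x≈y
  if-then-cong false x≈y = ≈-refl

  if-then-zero : ∀ b {x} → x ≈ 0# → (if b then x else 0#) ≈ 0#
  if-then-zero true  x≈0 = x≈0
  if-then-zero false x≈0 = ≈-refl

  if-then-+ : ∀ b x y → (if b then x + y else 0#) ≈ (if b then x else 0#) + (if b then y else 0#)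
  if-then-+ true  x y = ≈-refl
  if-then-+ false x y = ≈-sym (+-identityˡ 0#)

  if-then-≡0 : ∀ d {n} → n ≡ 0 → (if d then n else 0) ≡ 0
  if-then-≡0 true  n≡0 = n≡0
  if-then-≡0 false _   = refl

  infixr 8 x₀^_∙_

  -- x₀^ a ∙ g = x₀^a · g (0, x₁, x₂, …)
  x₀^_∙_ : ℕ → Series k → Series k
  (x₀^ a ∙ g) β = if does (headExp β ≟ a) then g (0 ∷ tailExp β) else 0#

  1ˢ : Series k
  1ˢ β = natK k (embed [] β)

  x₀^-cong : ∀ a {g g′} → g ≈ˢ g′ → x₀^ a ∙ g ≈ˢ x₀^ a ∙ g′
  x₀^-cong a g≈g′ β = if-then-cong (does (headExp β ≟ a)) (g≈g′ _)

  x₀^-+ : ∀ a g h → x₀^ a ∙ (g +ˢ h) ≈ˢ x₀^ a ∙ g +ˢ x₀^ a ∙ h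
  x₀^-+ a g h β = if-then-+ (does (headExp β ≟ a)) _ _

  x₀^-zero : ∀ a {g} → g ≈ˢ 0ˢ → x₀^ a ∙ g ≈ˢ 0ˢ
  x₀^-zero a g≈0 β = if-then-zero (does (headExp β ≟ a)) (g≈0 _)

  ↓-x₀^-≢ : ∀ {a i} g → i ≢ a → (x₀^ a ∙ g) ↓ i ≈ˢ 0ˢ
  ↓-x₀^-≢ {a} {i} g i≢a β = reflexive (Bool.if-cong (dec-false (i ≟ a) i≢a))

  ↓-x₀^-≡ : ∀ a g → (x₀^ a ∙ g) ↓ a ≈ˢ g ↓ 0
  ↓-x₀^-≡ a g β = reflexive (Bool.if-cong (dec-true (a ≟ a) refl))

  x₀^-*ˢ-x₀^ : ∀ a b g h → (x₀^ a ∙ g) *ˢ (x₀^ b ∙ h) ≈ˢ x₀^ (a ℕ.+ b) ∙ (g *ˢ h)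
  x₀^-*ˢ-x₀^ zero    zero    g h [] = ≈-refl
  x₀^-*ˢ-x₀^ zero    (suc b) g h [] = ≈-trans (+-identityʳ _) (zeroʳ _)
  x₀^-*ˢ-x₀^ (suc a) b       g h [] = ≈-trans (+-identityʳ _) (zeroˡ _)
  x₀^-*ˢ-x₀^ a       b       g h (e ∷ β) with e ≟ a ℕ.+ b
  ... | yes e≡a+b = begin
    ((x₀^ a ∙ g) *ˢ (x₀^ b ∙ h)) (e ∷ β)
      ≈⟨ *ˢ-∷ _ _ e β ⟩
    ∑[ i < suc e ] (((x₀^ a ∙ g) ↓ i) *ˢ ((x₀^ b ∙ h) ↓ (e ∸ i))) β
      ≈⟨ ∑<-single (suc e) _ a (s≤s a≤e) (λ i _ i≢a → *ˢ-zeroˡ ((x₀^ b ∙ h) ↓ (e ∸ i)) (↓-x₀^-≢ g i≢a) β) ⟩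
    (((x₀^ a ∙ g) ↓ a) *ˢ ((x₀^ b ∙ h) ↓ (e ∸ a))) β
      ≡⟨ ≡.cong (λ j → (((x₀^ a ∙ g) ↓ a) *ˢ ((x₀^ b ∙ h) ↓ j)) β) e∸a≡b ⟩
    (((x₀^ a ∙ g) ↓ a) *ˢ ((x₀^ b ∙ h) ↓ b)) β
      ≈⟨ *ˢ-cong (↓-x₀^-≡ a g) (↓-x₀^-≡ b h) β ⟩
    ((g ↓ 0) *ˢ (h ↓ 0)) β
      ≈⟨ +-identityʳ _ ⟨
    ((g ↓ 0) *ˢ (h ↓ 0)) β + 0#
      ≈⟨ *ˢ-∷ g h 0 β ⟨
    (g *ˢ h) (0 ∷ β)
      ≡⟨ Bool.if-cong (dec-true (e ≟ a ℕ.+ b) e≡a+b) ⟨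
    (x₀^ (a ℕ.+ b) ∙ (g *ˢ h)) (e ∷ β) ∎
    where
    open SetoidReasoning setoid
    a≤e : a ≤ e
    a≤e = ≡.subst (a ≤_) (≡.sym e≡a+b) (ℕ.m≤m+n a b)
    e∸a≡b : e ∸ a ≡ b
    e∸a≡b = ≡.trans (≡.cong (_∸ a) e≡a+b) (ℕ.m+n∸m≡n a b)
  ... | no e≢a+b =
    ≈-trans (*ˢ-∷ _ _ e β)
      (≈-trans (∑<-zero (suc e) _ vanish)
               (≈-sym (reflexive (Bool.if-cong (dec-false (e ≟ a ℕ.+ b) e≢a+b)))))
    where
    vanish : ∀ i → i < suc e → (((x₀^ a ∙ g) ↓ i) *ˢ ((x₀^ b ∙ h) ↓ (e ∸ i))) β ≈ 0#
    vanish i (s≤s i≤e) with i ≟ a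
    ... | yes refl = *ˢ-zeroʳ _ (↓-x₀^-≢ h e∸i≢b) β
      where
      e∸i≢b : e ∸ i ≢ b
      e∸i≢b e∸i≡b = e≢a+b (≡.trans (≡.sym (ℕ.m+[n∸m]≡n i≤e)) (≡.cong (i ℕ.+_) e∸i≡b))
    ... | no i≢a   = *ˢ-zeroˡ ((x₀^ b ∙ h) ↓ (e ∸ i)) (↓-x₀^-≢ g i≢a) β

  1ˢ-*ˢ : ∀ g → 1ˢ *ˢ g ≈ˢ g
  1ˢ-*ˢ g [] = ≈-trans (+-identityʳ _) (≈-trans (*-congʳ (+-identityʳ 1#)) (*-identityˡ _))
  1ˢ-*ˢ g (b ∷ β) =
    ≈-trans (*ˢ-∷ 1ˢ g b β)
      (≈-trans (∑<-single (suc b) _ 0 (s≤s z≤n) vanish) (1ˢ-*ˢ (g ↓ b) β))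
    where
    vanish : ∀ i → i < suc b → i ≢ 0 → ((1ˢ ↓ i) *ˢ (g ↓ (b ∸ i))) β ≈ 0#
    vanish zero    _ i≢0 = ⊥-elim (i≢0 refl)
    vanish (suc i) _ _   = *ˢ-zeroˡ _ (λ _ → ≈-refl) β

  *ˢ-1ˢ : ∀ g → g *ˢ 1ˢ ≈ˢ g
  *ˢ-1ˢ g [] = ≈-trans (+-identityʳ _) (≈-trans (*-congˡ (+-identityʳ 1#)) (*-identityʳ _))
  *ˢ-1ˢ g (b ∷ β) =
    ≈-trans (*ˢ-∷ g 1ˢ b β)
      (≈-trans (∑<-single (suc b) _ b ℕ.≤-refl vanish)
        (≈-trans (*ˢ-cong ≈ˢ-refl 1ˢ↓b∸b β)
          (*ˢ-1ˢ (g ↓ b) β)))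
    where
    1ˢ↓b∸b : 1ˢ ↓ (b ∸ b) ≈ˢ 1ˢ
    1ˢ↓b∸b β′ = reflexive (≡.cong (λ j → 1ˢ (j ∷ β′)) (ℕ.n∸n≡0 b))
    1ˢ↓suc : ∀ j → j ≢ 0 → 1ˢ ↓ j ≈ˢ 0ˢ
    1ˢ↓suc zero    j≢0 = ⊥-elim (j≢0 refl)
    1ˢ↓suc (suc j) _   = λ _ → ≈-refl
    vanish : ∀ i → i < suc b → i ≢ b → ((g ↓ i) *ˢ (1ˢ ↓ (b ∸ i))) β ≈ 0#
    vanish i (s≤s i≤b) i≢b =
      *ˢ-zeroʳ _ (1ˢ↓suc (b ∸ i) (i≢b ∘ ℕ.≤-antisym i≤b ∘ ℕ.m∸n≡0⇒m≤n)) β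

  natK-+ : ∀ m n → natK k (m ℕ.+ n) ≈ natK k m + natK k n
  natK-+ zero    n = ≈-sym (+-identityˡ _)
  natK-+ (suc m) n = ≈-trans (+-congˡ (natK-+ m n)) (≈-sym (+-assoc _ _ _))

  natK-if : ∀ d n → (if d then natK k n else 0#) ≈ natK k (if d then n else 0)
  natK-if true  n = ≈-refl
  natK-if false n = ≈-refl

  does-≟-sym : ∀ a b → does (a ≟ b) ≡ does (b ≟ a)
  does-≟-sym a b with a ≟ b
  ... | yes a≡b = ≡.trans (dec-true (a ≟ b) a≡b) (≡.sym (dec-true (b ≟ a) (≡.sym a≡b)))
  ... | no  a≢b = ≡.trans (dec-false (a ≟ b) a≢b) (≡.sym (dec-false (b ≟ a) (a≢b ∘ ≡.sym)))

  -- a₀ ◂ a₁ ◂ … ◂ end l  encodes  α = (a₀, a₁, …, 1 + l)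
  infixr 5 _◂_
  data Index : Set where
    end : ℕ → Index
    _◂_ : ℕ → Index → Index

  toIdx : Index → Idx
  toIdx (end l) = idx [] l
  toIdx (a ◂ w) = idx (a ∷ Idx.front (toIdx w)) (Idx.last (toIdx w))

  fromIdx : Idx → Index
  fromIdx (idx []      l) = end l
  fromIdx (idx (a ∷ f) l) = a ◂ fromIdx (idx f l)

  toIdx-fromIdx : ∀ α → toIdx (fromIdx α) ≡ α
  toIdx-fromIdx (idx []      l) = refl
  toIdx-fromIdx (idx (a ∷ f) l) =
    ≡.cong (λ α → idx (a ∷ Idx.front α) (Idx.last α)) (toIdx-fromIdx (idx f l))

  fromIdx-toIdx : ∀ w → fromIdx (toIdx w) ≡ w
  fromIdx-toIdx (end l) = refl
  fromIdx-toIdx (a ◂ w) = ≡.cong (a ◂_) (fromIdx-toIdx w)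

  toWord : Index → List ℕ
  toWord w = word (toIdx w)

  M : Index → Series k
  M w = Mbar k (toIdx w)

  M-fromIdx : ∀ α → M (fromIdx α) ≈ˢ Mbar k α
  M-fromIdx α β = reflexive (≡.cong (λ α′ → Mbar k α′ β) (toIdx-fromIdx α))

  -- x₀^a · M_{as}, when the last entry of a ∷ as is positive
  headed : ℕ → List ℕ → Series k
  headed a as β = if does (headExp β ≟ a) then natK k (embed as (tailExp β)) else 0#

  headed-∷ : ∀ a as b t → headed a as (b ∷ t) ≈ natK k (if does (a ≟ b) then embed as t else 0)
  headed-∷ a as b t =
    ≈-trans (reflexive (≡.cong (λ d → if d then natK k (embed as t) else 0#) (does-≟-sym b a)))
            (natK-if (does (a ≟ b)) (embed as t))

  -- natK (embed (a ∷ as) t) is the coefficient of x^t in ∑_{0 ≤ n₀ < n₁ < ⋯} x_{n₀}^a x_{n₁}^{as₁} ⋯;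
  -- split the sum according to whether n₀ = 0.
  headed-+-Pˢ : ∀ a as → headed a as [] ≈ 0# →
                ∀ t → headed a as t + Pˢ (headed a as) t ≈ natK k (embed (a ∷ as) t)
  headed-+-Pˢ a as h[]≈0 []          = ≈-trans (+-identityʳ _) h[]≈0
  headed-+-Pˢ a as h[]≈0 (zero ∷ t)  = begin
    headed a as (0 ∷ t) + (headed a as t + Pˢ (headed a as) t)
      ≈⟨ +-cong (headed-∷ a as 0 t) (headed-+-Pˢ a as h[]≈0 t) ⟩
    natK k (if does (a ≟ 0) then embed as t else 0) + natK k (embed (a ∷ as) t)
      ≈⟨ natK-+ (if does (a ≟ 0) then embed as t else 0) (embed (a ∷ as) t) ⟨
    natK k (embed (a ∷ as) (0 ∷ t)) ∎
    where open SetoidReasoning setoid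
  headed-+-Pˢ a as h[]≈0 (suc b ∷ t) = begin
    headed a as (suc b ∷ t) + 0#          ≈⟨ +-identityʳ _ ⟩
    headed a as (suc b ∷ t)               ≈⟨ headed-∷ a as (suc b) t ⟩
    natK k n                              ≡⟨ ≡.cong (natK k) (ℕ.+-identityʳ n) ⟨
    natK k (embed (a ∷ as) (suc b ∷ t))   ∎
    where
    open SetoidReasoning setoid
    n : ℕ
    n = if does (a ≟ suc b) then embed as t else 0

  M-[] : ∀ w → M w [] ≈ 0#
  M-[] (end _)         = ≈-refl
  M-[] (zero ◂ end _)   = ≈-refl
  M-[] (zero ◂ _ ◂ _)   = ≈-refl
  M-[] (suc _ ◂ _)      = ≈-refl

  M-+-Pˢ-M : ∀ w t → M w t + Pˢ (M w) t ≈ natK k (embed (toWord w) t)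
  M-+-Pˢ-M (end l) = headed-+-Pˢ (suc l) [] ≈-refl
  M-+-Pˢ-M (a ◂ w) = headed-+-Pˢ a (toWord w) (M-[] (a ◂ w))

  M-end : ∀ l → M (end l) ≈ˢ x₀^ suc l ∙ 1ˢ
  M-end l β = ≈-refl

  M-◂ : ∀ a w → M (a ◂ w) ≈ˢ x₀^ a ∙ Pˢ (M w)
  M-◂ a w β = if-then-cong (does (headExp β ≟ a)) (≈-sym (M-+-Pˢ-M w (tailExp β)))

  Pˢ-M : ∀ w → Pˢ (M w) ≈ˢ M (0 ◂ w)
  Pˢ-M w []          = ≈-sym (M-[] (0 ◂ w))
  Pˢ-M w (zero ∷ t)  = M-+-Pˢ-M w t
  Pˢ-M w (suc _ ∷ _) = ≈-refl

  *ˢ-x₀^ : ∀ {a b c f f′ g h} → a ℕ.+ b ≡ c → f ≈ˢ x₀^ a ∙ g → f′ ≈ˢ x₀^ b ∙ h →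
         f *ˢ f′ ≈ˢ x₀^ c ∙ (g *ˢ h)
  *ˢ-x₀^ {a} {b} {g = g} {h} refl f≈ f′≈ = ≈ˢ-trans (*ˢ-cong f≈ f′≈) (x₀^-*ˢ-x₀^ a b g h)

  Pˢ-M-x₀^ : ∀ w → Pˢ (M w) ≈ˢ x₀^ 0 ∙ Pˢ (M w)
  Pˢ-M-x₀^ w = ≈ˢ-trans (Pˢ-M w) (M-◂ 0 w)

  -- Quasi-shuffle products

  -- M̄_(a,α) · M̄_(b,β) = x₀^{a+b} · Pˢ (M̄_α) · Pˢ (M̄_β), expanded by the Rota–Baxter identity.
  mutual
    prod : Index → Index → List Index
    prod (end l) (end m) = [ end (l ℕ.+ suc m) ]
    prod (end l) (b ◂ v) = [ (suc l ℕ.+ b) ◂ v ]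
    prod (a ◂ u) (end m) = [ (a ℕ.+ suc m) ◂ u ]
    prod (a ◂ u) (b ◂ v) = map ((a ℕ.+ b) ◂_) (rbTerms u v)

    prod-P : Index → Index → List Index
    prod-P (end l) v = [ suc l ◂ v ]
    prod-P (a ◂ u) v = map (a ◂_) (rbTerms u v)

    P-prod : Index → Index → List Index
    P-prod u (end m) = [ suc m ◂ u ]
    P-prod u (b ◂ v) = map (b ◂_) (rbTerms u v)

    rbTerms : Index → Index → List Index
    rbTerms u v = (prod-P u v ++ P-prod u v) ++ prod u v

  ΣM : List Index → Series k
  ΣM ws β = ∑ (map (λ w → M w β) ws)

  ΣM-[] : ΣM [] ≈ˢ 0ˢ
  ΣM-[] β = ≈-refl

  ΣM-[_] : ∀ w → ΣM [ w ] ≈ˢ M w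
  ΣM-[ w ] β = +-identityʳ _

  ΣM-++ : ∀ vs ws → ΣM (vs ++ ws) ≈ˢ ΣM vs +ˢ ΣM ws
  ΣM-++ vs ws β = ∑-map-++ (λ w → M w β) vs ws

  ΣM-map-◂ : ∀ a ws → ΣM (map (a ◂_) ws) ≈ˢ x₀^ a ∙ Pˢ (ΣM ws)
  ΣM-map-◂ a []       = ≈ˢ-sym (x₀^-zero a (Pˢ-zero ΣM-[]))
  ΣM-map-◂ a (w ∷ ws) = begin
    M (a ◂ w) +ˢ ΣM (map (a ◂_) ws)          ≈⟨ +ˢ-cong (M-◂ a w) (ΣM-map-◂ a ws) ⟩
    x₀^ a ∙ Pˢ (M w) +ˢ x₀^ a ∙ Pˢ (ΣM ws)   ≈⟨ x₀^-+ a (Pˢ (M w)) (Pˢ (ΣM ws)) ⟨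
    x₀^ a ∙ (Pˢ (M w) +ˢ Pˢ (ΣM ws))         ≈⟨ x₀^-cong a (Pˢ-+ (M w) (ΣM ws)) ⟨
    x₀^ a ∙ Pˢ (M w +ˢ ΣM ws)                ∎
    where open SetoidReasoning seriesSetoid

  mutual
    ΣM-prod : ∀ u v → ΣM (prod u v) ≈ˢ M u *ˢ M v
    ΣM-prod (end l) (end m) = begin
      ΣM [ end (l ℕ.+ suc m) ]              ≈⟨ ΣM-[ end (l ℕ.+ suc m) ] ⟩
      x₀^ suc l ℕ.+ suc m ∙ 1ˢ              ≈⟨ x₀^-cong (suc l ℕ.+ suc m) (1ˢ-*ˢ 1ˢ) ⟨
      x₀^ suc l ℕ.+ suc m ∙ (1ˢ *ˢ 1ˢ)      ≈⟨ *ˢ-x₀^ refl (M-end l) (M-end m) ⟨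
      M (end l) *ˢ M (end m)                ∎
      where open SetoidReasoning seriesSetoid
    ΣM-prod (end l) (b ◂ v) = begin
      ΣM [ (suc l ℕ.+ b) ◂ v ]              ≈⟨ ≈ˢ-trans ΣM-[ (suc l ℕ.+ b) ◂ v ] (M-◂ _ v) ⟩
      x₀^ suc l ℕ.+ b ∙ Pˢ (M v)            ≈⟨ x₀^-cong (suc l ℕ.+ b) (1ˢ-*ˢ (Pˢ (M v))) ⟨
      x₀^ suc l ℕ.+ b ∙ (1ˢ *ˢ Pˢ (M v))    ≈⟨ *ˢ-x₀^ refl (M-end l) (M-◂ b v) ⟨
      M (end l) *ˢ M (b ◂ v)                ∎
      where open SetoidReasoning seriesSetoid
    ΣM-prod (a ◂ u) (end m) = begin
      ΣM [ (a ℕ.+ suc m) ◂ u ]              ≈⟨ ≈ˢ-trans ΣM-[ (a ℕ.+ suc m) ◂ u ] (M-◂ _ u) ⟩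
      x₀^ a ℕ.+ suc m ∙ Pˢ (M u)            ≈⟨ x₀^-cong (a ℕ.+ suc m) (*ˢ-1ˢ (Pˢ (M u))) ⟨
      x₀^ a ℕ.+ suc m ∙ (Pˢ (M u) *ˢ 1ˢ)    ≈⟨ *ˢ-x₀^ refl (M-◂ a u) (M-end m) ⟨
      M (a ◂ u) *ˢ M (end m)                ∎
      where open SetoidReasoning seriesSetoid
    ΣM-prod (a ◂ u) (b ◂ v) = begin
      ΣM (map ((a ℕ.+ b) ◂_) (rbTerms u v))       ≈⟨ ΣM-map-◂ _ (rbTerms u v) ⟩
      x₀^ a ℕ.+ b ∙ Pˢ (ΣM (rbTerms u v))         ≈⟨ x₀^-cong _ (Pˢ-ΣM-rbTerms u v) ⟩
      x₀^ a ℕ.+ b ∙ (Pˢ (M u) *ˢ Pˢ (M v))        ≈⟨ *ˢ-x₀^ refl (M-◂ a u) (M-◂ b v) ⟨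
      M (a ◂ u) *ˢ M (b ◂ v)                      ∎
      where open SetoidReasoning seriesSetoid

    ΣM-prod-P : ∀ u v → ΣM (prod-P u v) ≈ˢ M u *ˢ Pˢ (M v)
    ΣM-prod-P (end l) v = begin
      ΣM [ suc l ◂ v ]                      ≈⟨ ≈ˢ-trans ΣM-[ suc l ◂ v ] (M-◂ (suc l) v) ⟩
      x₀^ suc l ∙ Pˢ (M v)                  ≈⟨ x₀^-cong (suc l) (1ˢ-*ˢ (Pˢ (M v))) ⟨
      x₀^ suc l ∙ (1ˢ *ˢ Pˢ (M v))          ≈⟨ *ˢ-x₀^ (ℕ.+-identityʳ (suc l)) (M-end l) (Pˢ-M-x₀^ v) ⟨
      M (end l) *ˢ Pˢ (M v)                 ∎
      where open SetoidReasoning seriesSetoid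
    ΣM-prod-P (a ◂ u) v = begin
      ΣM (map (a ◂_) (rbTerms u v))         ≈⟨ ΣM-map-◂ a (rbTerms u v) ⟩
      x₀^ a ∙ Pˢ (ΣM (rbTerms u v))         ≈⟨ x₀^-cong a (Pˢ-ΣM-rbTerms u v) ⟩
      x₀^ a ∙ (Pˢ (M u) *ˢ Pˢ (M v))        ≈⟨ *ˢ-x₀^ (ℕ.+-identityʳ a) (M-◂ a u) (Pˢ-M-x₀^ v) ⟨
      M (a ◂ u) *ˢ Pˢ (M v)                 ∎
      where open SetoidReasoning seriesSetoid

    ΣM-P-prod : ∀ u v → ΣM (P-prod u v) ≈ˢ Pˢ (M u) *ˢ M v
    ΣM-P-prod u (end m) = begin
      ΣM [ suc m ◂ u ]                      ≈⟨ ≈ˢ-trans ΣM-[ suc m ◂ u ] (M-◂ (suc m) u) ⟩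
      x₀^ suc m ∙ Pˢ (M u)                  ≈⟨ x₀^-cong (suc m) (*ˢ-1ˢ (Pˢ (M u))) ⟨
      x₀^ suc m ∙ (Pˢ (M u) *ˢ 1ˢ)          ≈⟨ *ˢ-x₀^ refl (Pˢ-M-x₀^ u) (M-end m) ⟨
      Pˢ (M u) *ˢ M (end m)                 ∎
      where open SetoidReasoning seriesSetoid
    ΣM-P-prod u (b ◂ v) = begin
      ΣM (map (b ◂_) (rbTerms u v))         ≈⟨ ΣM-map-◂ b (rbTerms u v) ⟩
      x₀^ b ∙ Pˢ (ΣM (rbTerms u v))         ≈⟨ x₀^-cong b (Pˢ-ΣM-rbTerms u v) ⟩
      x₀^ b ∙ (Pˢ (M u) *ˢ Pˢ (M v))        ≈⟨ *ˢ-x₀^ refl (Pˢ-M-x₀^ u) (M-◂ b v) ⟨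
      Pˢ (M u) *ˢ M (b ◂ v)                 ∎
      where open SetoidReasoning seriesSetoid

    Pˢ-ΣM-rbTerms : ∀ u v → Pˢ (ΣM (rbTerms u v)) ≈ˢ Pˢ (M u) *ˢ Pˢ (M v)
    Pˢ-ΣM-rbTerms u v = begin
      Pˢ (ΣM ((prod-P u v ++ P-prod u v) ++ prod u v))
        ≈⟨ Pˢ-cong (≈ˢ-trans (ΣM-++ (prod-P u v ++ P-prod u v) (prod u v))
                            (+ˢ-cong (ΣM-++ (prod-P u v) (P-prod u v)) ≈ˢ-refl)) ⟩
      Pˢ (ΣM (prod-P u v) +ˢ ΣM (P-prod u v) +ˢ ΣM (prod u v))
        ≈⟨ ≈ˢ-trans (Pˢ-+ (ΣM (prod-P u v) +ˢ ΣM (P-prod u v)) (ΣM (prod u v)))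
                   (+ˢ-cong (Pˢ-+ (ΣM (prod-P u v)) (ΣM (P-prod u v))) ≈ˢ-refl) ⟩
      Pˢ (ΣM (prod-P u v)) +ˢ Pˢ (ΣM (P-prod u v)) +ˢ Pˢ (ΣM (prod u v))
        ≈⟨ +ˢ-cong (+ˢ-cong (Pˢ-cong (ΣM-prod-P u v)) (Pˢ-cong (ΣM-P-prod u v)))
                   (Pˢ-cong (ΣM-prod u v)) ⟩
      Pˢ (M u *ˢ Pˢ (M v)) +ˢ Pˢ (Pˢ (M u) *ˢ M v) +ˢ Pˢ (M u *ˢ M v)
        ≈⟨ Pˢ-rotaBaxter (M u) (M v) ⟨
      Pˢ (M u) *ˢ Pˢ (M v) ∎
      where open SetoidReasoning seriesSetoid

  Combination : Set c
  Combination = List (Carrier × Index)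

  ⟦_⟧ : Combination → Series k
  ⟦ G ⟧ β = ∑ (map (λ x → proj₁ x * M (proj₂ x) β) G)

  ⟦⟧-inSpan : ∀ G → InSpan k ⟦ G ⟧
  ⟦⟧-inSpan []            = zer
  ⟦⟧-inSpan ((a , w) ∷ G) = add (scale a (basis (toIdx w))) (⟦⟧-inSpan G)

  ⟦⟧-++ : ∀ G H → ⟦ G ++ H ⟧ ≈ˢ ⟦ G ⟧ +ˢ ⟦ H ⟧
  ⟦⟧-++ G H β = ∑-map-++ (λ x → proj₁ x * M (proj₂ x) β) G H

  infixr 7 _·ᶜ_
  _·ᶜ_ : Carrier → Combination → Combination
  a ·ᶜ G = map (λ x → (a * proj₁ x , proj₂ x)) G

  ⟦⟧-·ᶜ : ∀ a G → ⟦ a ·ᶜ G ⟧ ≈ˢ a ·ˢ ⟦ G ⟧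
  ⟦⟧-·ᶜ a G β =
    ≈-trans (reflexive (≡.cong ∑ (≡.sym (List.map-∘ G))))
            (≈-trans (∑-cong G (λ x → *-assoc _ _ _)) (∑-*ˡ G a (λ x → proj₁ x * M (proj₂ x) β)))

  ⟦⟧-map-, : ∀ a ws → ⟦ map (a ,_) ws ⟧ ≈ˢ a ·ˢ ΣM ws
  ⟦⟧-map-, a ws β =
    ≈-trans (reflexive (≡.cong ∑ (≡.sym (List.map-∘ ws)))) (∑-*ˡ ws a (λ w → M w β))

  combination : ∀ {f} → InSpan k f → Combination
  combination (basis α)   = [ (1# , fromIdx α) ]
  combination zer         = []
  combination (add p q)   = combination p ++ combination q
  combination (scale a p) = a ·ᶜ combination p
  combination (resp _ p)  = combination p

  ⟦combination⟧ : ∀ {f} (p : InSpan k f) → ⟦ combination p ⟧ ≈ˢ f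
  ⟦combination⟧ (basis α) β =
    ≈-trans (+-identityʳ _) (≈-trans (*-identityˡ _) (M-fromIdx α β))
  ⟦combination⟧ zer          = ≈ˢ-refl
  ⟦combination⟧ (add p q)    =
    ≈ˢ-trans (⟦⟧-++ (combination p) (combination q)) (+ˢ-cong (⟦combination⟧ p) (⟦combination⟧ q))
  ⟦combination⟧ (scale a p)  = ≈ˢ-trans (⟦⟧-·ᶜ a (combination p)) (λ β → *-congˡ (⟦combination⟧ p β))
  ⟦combination⟧ (resp f≈g p) = ≈ˢ-trans (⟦combination⟧ p) f≈g

  prodᶜ : Carrier × Index → Carrier × Index → Combination
  prodᶜ (a , u) (b , v) = map (a * b ,_) (prod u v)

  infixl 7 _*ᶜ_
  _*ᶜ_ : Combination → Combination → Combination
  G *ᶜ H = concatMap (λ x → concatMap (prodᶜ x) H) G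

  ⟦prodᶜ⟧ : ∀ a u b v → ⟦ prodᶜ (a , u) (b , v) ⟧ ≈ˢ (a ·ˢ M u) *ˢ (b ·ˢ M v)
  ⟦prodᶜ⟧ a u b v = begin
    ⟦ map (a * b ,_) (prod u v) ⟧    ≈⟨ ⟦⟧-map-, (a * b) (prod u v) ⟩
    (a * b) ·ˢ ΣM (prod u v)         ≈⟨ (λ β → *-congˡ (ΣM-prod u v β)) ⟩
    (a * b) ·ˢ (M u *ˢ M v)          ≈⟨ ·ˢ-*ˢ-·ˢ a b (M u) (M v) ⟨
    (a ·ˢ M u) *ˢ (b ·ˢ M v)         ∎
    where open SetoidReasoning seriesSetoid

  ⟦⟧-*ᶜ : ∀ G H → ⟦ G *ᶜ H ⟧ ≈ˢ ⟦ G ⟧ *ˢ ⟦ H ⟧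
  ⟦⟧-*ᶜ []            H = ≈ˢ-sym (*ˢ-zeroˡ ⟦ H ⟧ ≈ˢ-refl)
  ⟦⟧-*ᶜ ((a , u) ∷ G) H =
    ≈ˢ-trans (⟦⟧-++ (concatMap (prodᶜ (a , u)) H) (G *ᶜ H))
      (≈ˢ-trans (+ˢ-cong (⟦⟧-prodᶜ-right H) (⟦⟧-*ᶜ G H))
                (≈ˢ-sym (*ˢ-distribʳ ⟦ H ⟧ (a ·ˢ M u) ⟦ G ⟧)))
    where
    ⟦⟧-prodᶜ-right : ∀ H → ⟦ concatMap (prodᶜ (a , u)) H ⟧ ≈ˢ (a ·ˢ M u) *ˢ ⟦ H ⟧
    ⟦⟧-prodᶜ-right []            = ≈ˢ-sym (*ˢ-zeroʳ (a ·ˢ M u) ≈ˢ-refl)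
    ⟦⟧-prodᶜ-right ((b , v) ∷ H) =
      ≈ˢ-trans (⟦⟧-++ (prodᶜ (a , u) (b , v)) (concatMap (prodᶜ (a , u)) H))
        (≈ˢ-trans (+ˢ-cong (⟦prodᶜ⟧ a u b v) (⟦⟧-prodᶜ-right H))
          (≈ˢ-sym (*ˢ-distribˡ (a ·ˢ M u) (b ·ˢ M v) ⟦ H ⟧)))

  Pᶜ : Combination → Combination
  Pᶜ = map (λ x → (proj₁ x , 0 ◂ proj₂ x))

  ⟦⟧-Pᶜ : ∀ G → ⟦ Pᶜ G ⟧ ≈ˢ Pˢ ⟦ G ⟧
  ⟦⟧-Pᶜ []            = ≈ˢ-sym (Pˢ-zero ≈ˢ-refl)
  ⟦⟧-Pᶜ ((a , w) ∷ G) β =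
    ≈-trans (+-cong (≈-trans (*-congˡ (≈-sym (Pˢ-M w β))) (≈-sym (Pˢ-· a (M w) β))) (⟦⟧-Pᶜ G β))
            (≈-sym (Pˢ-+ (a ·ˢ M w) ⟦ G ⟧ β))

  mulClosed : MulClosed k
  mulClosed p q =
    resp (≈ˢ-trans (⟦⟧-*ᶜ (combination p) (combination q)) (*ˢ-cong (⟦combination⟧ p) (⟦combination⟧ q)))
         (⟦⟧-inSpan (combination p *ᶜ combination q))

  PQ : Sub k → Sub k
  PQ (f , p) =
    Pˢ f , resp (≈ˢ-trans (⟦⟧-Pᶜ (combination p)) (Pˢ-cong (⟦combination⟧ p))) (⟦⟧-inSpan (Pᶜ (combination p)))

  PQ-linear : IsLinearSub k PQ
  PQ-linear = (λ _ _ → Pˢ-cong) , (λ x y → Pˢ-+ (proj₁ x) (proj₁ y)) , (λ a x → Pˢ-· a (proj₁ x))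

  PQ-basis : ∀ α → proj₁ (PQ (Mbar k α , basis α)) ≈ˢ Mbar k (cons0 α)
  PQ-basis α = ≈ˢ-trans (Pˢ-cong (≈ˢ-sym (M-fromIdx α))) (≈ˢ-trans (Pˢ-M (fromIdx α)) (M-fromIdx (cons0 α)))

  PQ-rotaBaxter : IsRotaBaxterSub k mulClosed PQ
  PQ-rotaBaxter (f , _) (g , _) = Pˢ-rotaBaxter f g

  -- Linear independence of the M̄_α

  ◂-injective : ∀ {a b u w} → a ◂ u ≡ b ◂ w → a ≡ b × u ≡ w
  ◂-injective refl = refl , refl

  infix 4 _≟ᵢ_
  _≟ᵢ_ : DecidableEquality Index
  end l ≟ᵢ end m = Dec.map′ (≡.cong end) (λ { refl → refl }) (l ≟ m)
  end _ ≟ᵢ _ ◂ _ = no (λ ())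
  _ ◂ _ ≟ᵢ end _ = no (λ ())
  a ◂ u ≟ᵢ b ◂ w =
    Dec.map′ (λ (a≡b , u≡w) → ≡.cong₂ _◂_ a≡b u≡w) ◂-injective (a ≟ b ×-dec u ≟ᵢ w)

  ∣_∣ : Index → ℕ
  ∣ w ∣ = length (toWord w)

  embed-toWord-[] : ∀ w → embed (toWord w) [] ≡ 0
  embed-toWord-[] (end _) = refl
  embed-toWord-[] (_ ◂ _) = refl

  embed-short : ∀ w bs → length bs < ∣ w ∣ → embed (toWord w) bs ≡ 0
  embed-short w       []       _         = embed-toWord-[] w
  embed-short (end _) (_ ∷ _)  (s≤s ())
  embed-short (a ◂ w) (b ∷ bs) (s≤s bs<w) =
    ≡.cong₂ ℕ._+_ (if-then-≡0 (does (a ≟ b)) (embed-short w bs bs<w))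
                  (if-then-≡0 (does (b ≟ 0)) (embed-short (a ◂ w) bs (ℕ.m<n⇒m<1+n bs<w)))

  embed-self : ∀ w → embed (toWord w) (toWord w) ≡ 1
  embed-self (end l) = ≡.cong (ℕ._+ 0) (Bool.if-cong (dec-true (suc l ≟ suc l) refl))
  embed-self (a ◂ w) =
    ≡.cong₂ ℕ._+_ (≡.trans (Bool.if-cong (dec-true (a ≟ a) refl)) (embed-self w))
                  (if-then-≡0 (does (a ≟ 0)) (embed-short (a ◂ w) (toWord w) (ℕ.n<1+n ∣ w ∣)))

  embed-distinct : ∀ u w → ∣ w ∣ ≤ ∣ u ∣ → u ≢ w → embed (toWord u) (toWord w) ≡ 0
  embed-distinct (end l) (end m) _ u≢w =
    ≡.cong (ℕ._+ 0) (Bool.if-cong (dec-false (suc l ≟ suc m) (u≢w ∘ ≡.cong (end ∘ ℕ.pred))))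
  embed-distinct (end _) (_ ◂ end _) (s≤s ())
  embed-distinct (end _) (_ ◂ _ ◂ _) (s≤s ())
  embed-distinct (a ◂ u) (end m) _ _ =
    ≡.cong (ℕ._+ 0) (if-then-≡0 (does (a ≟ suc m)) (embed-toWord-[] u))
  embed-distinct (a ◂ u) (b ◂ w) (s≤s w≤u) u≢w =
    ≡.cong₂ ℕ._+_ heads (if-then-≡0 (does (b ≟ 0)) (embed-short (a ◂ u) (toWord w) (s≤s w≤u)))
    where
    heads : (if does (a ≟ b) then embed (toWord u) (toWord w) else 0) ≡ 0
    heads with a ≟ b
    ... | yes refl = ≡.trans (Bool.if-cong (dec-true (a ≟ a) refl))
                             (embed-distinct u w w≤u (λ u≡w → u≢w (≡.cong (a ◂_) u≡w)))
    ... | no  a≢b  = Bool.if-cong (dec-false (a ≟ b) a≢b)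

  headed-embed : ∀ a as b t → embed (a ∷ as) t ≡ 0 →
                 headed a as (b ∷ t) ≈ natK k (embed (a ∷ as) (b ∷ t))
  headed-embed a as b t embed≡0 =
    ≈-trans (headed-∷ a as b t) (reflexive (≡.cong (natK k) (≡.sym drop-second)))
    where
    first : ℕ
    first = if does (a ≟ b) then embed as t else 0
    drop-second : embed (a ∷ as) (b ∷ t) ≡ first
    drop-second =
      ≡.trans (≡.cong (first ℕ.+_) (if-then-≡0 (does (b ≟ 0)) embed≡0)) (ℕ.+-identityʳ first)

  M-toWord : ∀ u w → ∣ w ∣ ≤ ∣ u ∣ → M u (toWord w) ≈ natK k (embed (toWord u) (toWord w))
  M-toWord (end l) (end m)     _     = headed-embed (suc l) [] (suc m) [] refl
  M-toWord (end _) (_ ◂ end _) (s≤s ())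
  M-toWord (end _) (_ ◂ _ ◂ _) (s≤s ())
  M-toWord (a ◂ u) (end m)     _     = headed-embed a (toWord u) (suc m) [] refl
  M-toWord (a ◂ u) (b ◂ w)     w≤u   =
    headed-embed a (toWord u) b (toWord w) (embed-short (a ◂ u) (toWord w) w≤u)

  M-toWord-self : ∀ w → M w (toWord w) ≈ 1#
  M-toWord-self w =
    ≈-trans (M-toWord w w ℕ.≤-refl) (≈-trans (reflexive (≡.cong (natK k) (embed-self w))) (+-identityʳ 1#))

  M-toWord-distinct : ∀ u w → ∣ w ∣ ≤ ∣ u ∣ → u ≢ w → M u (toWord w) ≈ 0#
  M-toWord-distinct u w w≤u u≢w =
    ≈-trans (M-toWord u w w≤u) (reflexive (≡.cong (natK k) (embed-distinct u w w≤u u≢w)))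

  coeff : Index → Combination → Carrier
  coeff w [] = 0#
  coeff w ((a , u) ∷ G) with u ≟ᵢ w
  ... | yes _ = a + coeff w G
  ... | no  _ = coeff w G

  without : Index → Combination → Combination
  without w = filter (λ x → ¬? (proj₂ x ≟ᵢ w))

  ⟦⟧-split : ∀ w G → ⟦ G ⟧ ≈ˢ coeff w G ·ˢ M w +ˢ ⟦ without w G ⟧
  ⟦⟧-split w [] β = ≈-sym (≈-trans (+-identityʳ _) (zeroˡ _))
  ⟦⟧-split w ((a , u) ∷ G) β with u ≟ᵢ w
  ... | yes refl =
    ≈-trans (+-congˡ (⟦⟧-split u G β))
            (≈-trans (≈-sym (+-assoc _ _ _)) (+-congʳ (≈-sym (distribʳ _ _ _))))
  ... | no  _    =
    ≈-trans (+-congˡ (⟦⟧-split w G β)) (x∙yz≈y∙xz _ _ _)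
    where open CommSemigroupProperties +-commutativeSemigroup using (x∙yz≈y∙xz)

  ⟦⟧-toWord-least : ∀ w G → All (λ x → ∣ w ∣ ≤ ∣ proj₂ x ∣) G → ⟦ G ⟧ (toWord w) ≈ coeff w G
  ⟦⟧-toWord-least w []            []              = ≈-refl
  ⟦⟧-toWord-least w ((a , u) ∷ G) (w≤u ∷ w≤G) with u ≟ᵢ w
  ... | yes refl =
    +-cong (≈-trans (*-congˡ (M-toWord-self u)) (*-identityʳ a)) (⟦⟧-toWord-least w G w≤G)
  ... | no  u≢w  =
    ≈-trans (+-cong (≈-trans (*-congˡ (M-toWord-distinct u w w≤u u≢w)) (zeroʳ a))
                    (⟦⟧-toWord-least w G w≤G))
            (+-identityˡ _)

  module Independence {m ℓm} (N : Module k m ℓm) (e : Index → Module.Carrierᴹ N) where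
    open Module N
    open ModuleProperties N using (inverseˡ-uniqueᴹ)

    extend : Combination → Carrierᴹ
    extend []            = 0ᴹ
    extend ((a , w) ∷ G) = a *ₗ e w +ᴹ extend G

    extend-++ : ∀ G H → extend (G ++ H) ≈ᴹ extend G +ᴹ extend H
    extend-++ []      H = ≈ᴹ-sym (+ᴹ-identityˡ _)
    extend-++ (_ ∷ G) H = ≈ᴹ-trans (+ᴹ-congˡ (extend-++ G H)) (≈ᴹ-sym (+ᴹ-assoc _ _ _))

    extend-·ᶜ : ∀ a G → extend (a ·ᶜ G) ≈ᴹ a *ₗ extend G
    extend-·ᶜ a []            = ≈ᴹ-sym (*ₗ-zeroʳ a)
    extend-·ᶜ a ((b , w) ∷ G) =
      ≈ᴹ-trans (+ᴹ-cong (*ₗ-assoc a b (e w)) (extend-·ᶜ a G)) (≈ᴹ-sym (*ₗ-distribˡ a _ _))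

    extend-split : ∀ w G → extend G ≈ᴹ coeff w G *ₗ e w +ᴹ extend (without w G)
    extend-split w [] = ≈ᴹ-sym (≈ᴹ-trans (+ᴹ-identityʳ _) (*ₗ-zeroˡ _))
    extend-split w ((a , u) ∷ G) with u ≟ᵢ w
    ... | yes refl =
      ≈ᴹ-trans (+ᴹ-congˡ (extend-split u G))
        (≈ᴹ-trans (≈ᴹ-sym (+ᴹ-assoc _ _ _)) (+ᴹ-congʳ (≈ᴹ-sym (*ₗ-distribʳ (e u) a _))))
    ... | no  _    = ≈ᴹ-trans (+ᴹ-congˡ (extend-split w G)) (x∙yz≈y∙xz _ _ _)
      where
      open CommSemigroupProperties (CommutativeMonoid.commutativeSemigroup +ᴹ-commutativeMonoid)
        using (x∙yz≈y∙xz)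

    -- At the monomial of an index w of least length in G, ⟦ G ⟧ reads off the total coefficient
    -- of w in G; so that coefficient vanishes and w can be dropped.
    extend-zero : ∀ G → ⟦ G ⟧ ≈ˢ 0ˢ → extend G ≈ᴹ 0ᴹ
    extend-zero G = by-length (length G) G ℕ.≤-refl
      where
      by-length : ∀ n G → length G ≤ n → ⟦ G ⟧ ≈ˢ 0ˢ → extend G ≈ᴹ 0ᴹ
      by-length _       []      _   _     = ≈ᴹ-refl
      by-length (suc n) (x ∷ G) len G≈0 =
        ≈ᴹ-trans (extend-split w (x ∷ G))
          (≈ᴹ-trans (+ᴹ-cong (≈ᴹ-trans (*ₗ-congʳ c≈0) (*ₗ-zeroˡ (e w)))
                             (by-length n rest shorter rest≈0))
                    (+ᴹ-identityʳ 0ᴹ))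
        where
        least : Σ (Carrier × Index) λ m →
                  m ∈ x ∷ G × All (λ y → ∣ proj₂ m ∣ ≤ ∣ proj₂ y ∣) (x ∷ G)
        least = leastBy (∣_∣ ∘ proj₂) x G
        w : Index
        w = proj₂ (proj₁ least)
        rest : Combination
        rest = without w (x ∷ G)
        c≈0 : coeff w (x ∷ G) ≈ 0#
        c≈0 = ≈-trans (≈-sym (⟦⟧-toWord-least w (x ∷ G) (proj₂ (proj₂ least)))) (G≈0 (toWord w))
        rest≈0 : ⟦ rest ⟧ ≈ˢ 0ˢ
        rest≈0 β = ≈-trans (≈-sym (+-identityˡ _))
          (≈-trans (+-congʳ (≈-sym (≈-trans (*-congʳ c≈0) (zeroˡ _))))
            (≈-trans (≈-sym (⟦⟧-split w (x ∷ G) β)) (G≈0 β)))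
        w-in-G : Any (λ y → ¬ (proj₂ y ≢ w)) (x ∷ G)
        w-in-G = Any.map (λ m≡y y≢w → y≢w (≡.cong proj₂ (≡.sym m≡y))) (proj₁ (proj₂ least))
        shorter : length rest ≤ n
        shorter =
          ℕ.≤-pred (ℕ.≤-trans (List.filter-notAll (λ y → ¬? (proj₂ y ≟ᵢ w)) (x ∷ G) w-in-G) len)

    extend-cong : ∀ G H → ⟦ G ⟧ ≈ˢ ⟦ H ⟧ → extend G ≈ᴹ extend H
    extend-cong G H G≈H =
      ≈ᴹ-trans (inverseˡ-uniqueᴹ (extend G) ((- 1#) *ₗ extend H) difference≈0)
               (≈ᴹ-sym (inverseˡ-uniqueᴹ (extend H) ((- 1#) *ₗ extend H) cancel))
      where
      -H : Combination
      -H = (- 1#) ·ᶜ H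
      ⟦difference⟧≈0 : ⟦ G ++ -H ⟧ ≈ˢ 0ˢ
      ⟦difference⟧≈0 β =
        ≈-trans (⟦⟧-++ G -H β)
          (≈-trans (+-cong (G≈H β) (≈-trans (⟦⟧-·ᶜ (- 1#) H β) (-1*x≈-x (⟦ H ⟧ β))))
                   (-‿inverseʳ _))
        where open RingProperties ring using (-1*x≈-x)
      difference≈0 : extend G +ᴹ (- 1#) *ₗ extend H ≈ᴹ 0ᴹ
      difference≈0 =
        ≈ᴹ-trans (≈ᴹ-sym (≈ᴹ-trans (extend-++ G -H) (+ᴹ-congˡ (extend-·ᶜ (- 1#) H))))
                 (extend-zero (G ++ -H) ⟦difference⟧≈0)
      cancel : extend H +ᴹ (- 1#) *ₗ extend H ≈ᴹ 0ᴹ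
      cancel =
        ≈ᴹ-trans (+ᴹ-congʳ (≈ᴹ-sym (*ₗ-identityˡ _)))
          (≈ᴹ-trans (≈ᴹ-sym (*ₗ-distribʳ _ 1# (- 1#)))
                    (≈ᴹ-trans (*ₗ-congʳ (-‿inverseʳ 1#)) (*ₗ-zeroˡ _)))

  -- The universal property

  basisᵢ : Index → Sub k
  basisᵢ w = M w , basis (toIdx w)

  generator : Sub k
  generator = basisᵢ (end 0)

  x₀·_ : Index → Index
  x₀· end l   = end (suc l)
  x₀· (a ◂ w) = suc a ◂ w

  M-x₀· : ∀ w → M (x₀· w) ≈ˢ M (end 0) *ˢ M w
  M-x₀· (end l) = ≈ˢ-trans (≈ˢ-sym ΣM-[ end (suc l) ]) (ΣM-prod (end 0) (end l))
  M-x₀· (a ◂ w) = ≈ˢ-trans (≈ˢ-sym ΣM-[ suc a ◂ w ]) (ΣM-prod (end 0) (a ◂ w))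

  module Universal {m ℓm} (R : RBAlgebra k m ℓm) (r : RBAlgebra.Carrierᴹ R) where
    open RBAlgebra R

    ·-zeroʳ : ∀ x → x · 0ᴹ ≈ᴹ 0ᴹ
    ·-zeroʳ x =
      ≈ᴹ-trans (·-cong ≈ᴹ-refl (≈ᴹ-sym (*ₗ-zeroˡ 0ᴹ))) (≈ᴹ-trans (·-*ₗ 0# x 0ᴹ) (*ₗ-zeroˡ _))

    ·-zeroˡ : ∀ x → 0ᴹ · x ≈ᴹ 0ᴹ
    ·-zeroˡ x = ≈ᴹ-trans (·-comm 0ᴹ x) (·-zeroʳ x)

    P-zero : P 0ᴹ ≈ᴹ 0ᴹ
    P-zero = ≈ᴹ-trans (P-cong (≈ᴹ-sym (*ₗ-zeroˡ 0ᴹ))) (≈ᴹ-trans (P-*ₗ 0# 0ᴹ) (*ₗ-zeroˡ _))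

    infixr 8 r^_∙_
    r^_∙_ : ℕ → Carrierᴹ → Carrierᴹ
    r^ zero  ∙ x = x
    r^ suc a ∙ x = r · (r^ a ∙ x)

    r^-cong : ∀ a {x y} → x ≈ᴹ y → r^ a ∙ x ≈ᴹ r^ a ∙ y
    r^-cong zero    x≈y = x≈y
    r^-cong (suc a) x≈y = ·-cong ≈ᴹ-refl (r^-cong a x≈y)

    r^-+ : ∀ a x y → r^ a ∙ (x +ᴹ y) ≈ᴹ r^ a ∙ x +ᴹ r^ a ∙ y
    r^-+ zero    x y = ≈ᴹ-refl
    r^-+ (suc a) x y = ≈ᴹ-trans (·-cong ≈ᴹ-refl (r^-+ a x y)) (·-distribˡ r _ _)

    r^-zero : ∀ a → r^ a ∙ 0ᴹ ≈ᴹ 0ᴹ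
    r^-zero zero    = ≈ᴹ-refl
    r^-zero (suc a) = ≈ᴹ-trans (·-cong ≈ᴹ-refl (r^-zero a)) (·-zeroʳ r)

    r^-·ˡ : ∀ a x y → (r^ a ∙ x) · y ≈ᴹ r^ a ∙ (x · y)
    r^-·ˡ zero    x y = ≈ᴹ-refl
    r^-·ˡ (suc a) x y = ≈ᴹ-trans (·-assoc r (r^ a ∙ x) y) (·-cong ≈ᴹ-refl (r^-·ˡ a x y))

    r^-·ʳ : ∀ b x y → x · (r^ b ∙ y) ≈ᴹ r^ b ∙ (x · y)
    r^-·ʳ b x y = ≈ᴹ-trans (·-comm x (r^ b ∙ y)) (≈ᴹ-trans (r^-·ˡ b y x) (r^-cong b (·-comm y x)))

    r^-r^ : ∀ a b x → r^ a ℕ.+ b ∙ x ≡ r^ a ∙ r^ b ∙ x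
    r^-r^ zero    b x = refl
    r^-r^ (suc a) b x = ≡.cong (r ·_) (r^-r^ a b x)

    r^-suc : ∀ a x → r^ suc a ∙ x ≡ r^ a ∙ (r · x)
    r^-suc zero    x = refl
    r^-suc (suc a) x = ≡.cong (r ·_) (r^-suc a x)

    r^-+-suc : ∀ a b x → r^ a ℕ.+ suc b ∙ x ≡ r^ a ℕ.+ b ∙ (r · x)
    r^-+-suc a b x = ≡.trans (≡.cong (r^_∙ x) (ℕ.+-suc a b)) (r^-suc (a ℕ.+ b) x)

    r^-·-r^ : ∀ a b x y → (r^ a ∙ x) · (r^ b ∙ y) ≈ᴹ r^ a ℕ.+ b ∙ (x · y)
    r^-·-r^ a b x y =
      ≈ᴹ-trans (r^-·ˡ a x (r^ b ∙ y))
               (≈ᴹ-trans (r^-cong a (r^-·ʳ b x y)) (≈ᴹ-reflexive (≡.sym (r^-r^ a b (x · y)))))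

    eval : Index → Carrierᴹ
    eval (end l) = r^ l ∙ r
    eval (a ◂ w) = r^ a ∙ P (eval w)

    evalΣ : List Index → Carrierᴹ
    evalΣ []       = 0ᴹ
    evalΣ (w ∷ ws) = eval w +ᴹ evalΣ ws

    evalΣ-[_] : ∀ w → evalΣ [ w ] ≈ᴹ eval w
    evalΣ-[ w ] = +ᴹ-identityʳ _

    evalΣ-++ : ∀ vs ws → evalΣ (vs ++ ws) ≈ᴹ evalΣ vs +ᴹ evalΣ ws
    evalΣ-++ []       ws = ≈ᴹ-sym (+ᴹ-identityˡ _)
    evalΣ-++ (v ∷ vs) ws = ≈ᴹ-trans (+ᴹ-congˡ (evalΣ-++ vs ws)) (≈ᴹ-sym (+ᴹ-assoc _ _ _))

    evalΣ-map-◂ : ∀ a ws → evalΣ (map (a ◂_) ws) ≈ᴹ r^ a ∙ P (evalΣ ws)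
    evalΣ-map-◂ a []       = ≈ᴹ-sym (≈ᴹ-trans (r^-cong a P-zero) (r^-zero a))
    evalΣ-map-◂ a (w ∷ ws) =
      ≈ᴹ-trans (+ᴹ-congˡ (evalΣ-map-◂ a ws))
        (≈ᴹ-trans (≈ᴹ-sym (r^-+ a _ _)) (r^-cong a (≈ᴹ-sym (P-+ (eval w) (evalΣ ws)))))

    mutual
      evalΣ-prod : ∀ u v → evalΣ (prod u v) ≈ᴹ eval u · eval v
      evalΣ-prod (end l) (end m) = begin
        evalΣ [ end (l ℕ.+ suc m) ]      ≈⟨ evalΣ-[ end (l ℕ.+ suc m) ] ⟩
        r^ l ℕ.+ suc m ∙ r               ≡⟨ r^-+-suc l m r ⟩
        r^ l ℕ.+ m ∙ (r · r)             ≈⟨ r^-·-r^ l m r r ⟨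
        (r^ l ∙ r) · (r^ m ∙ r)          ∎
        where open SetoidReasoning ≈ᴹ-setoid
      evalΣ-prod (end l) (b ◂ v) = begin
        evalΣ [ (suc l ℕ.+ b) ◂ v ]      ≈⟨ evalΣ-[ (suc l ℕ.+ b) ◂ v ] ⟩
        r^ suc l ℕ.+ b ∙ P (eval v)      ≡⟨ r^-suc (l ℕ.+ b) (P (eval v)) ⟩
        r^ l ℕ.+ b ∙ (r · P (eval v))    ≈⟨ r^-·-r^ l b r (P (eval v)) ⟨
        (r^ l ∙ r) · (r^ b ∙ P (eval v)) ∎
        where open SetoidReasoning ≈ᴹ-setoid
      evalΣ-prod (a ◂ u) (end m) = begin
        evalΣ [ (a ℕ.+ suc m) ◂ u ]      ≈⟨ evalΣ-[ (a ℕ.+ suc m) ◂ u ] ⟩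
        r^ a ℕ.+ suc m ∙ P (eval u)      ≡⟨ r^-+-suc a m (P (eval u)) ⟩
        r^ a ℕ.+ m ∙ (r · P (eval u))    ≈⟨ r^-cong (a ℕ.+ m) (·-comm r (P (eval u))) ⟩
        r^ a ℕ.+ m ∙ (P (eval u) · r)    ≈⟨ r^-·-r^ a m (P (eval u)) r ⟨
        (r^ a ∙ P (eval u)) · (r^ m ∙ r) ∎
        where open SetoidReasoning ≈ᴹ-setoid
      evalΣ-prod (a ◂ u) (b ◂ v) = begin
        evalΣ (map ((a ℕ.+ b) ◂_) (rbTerms u v))   ≈⟨ evalΣ-map-◂ (a ℕ.+ b) (rbTerms u v) ⟩
        r^ a ℕ.+ b ∙ P (evalΣ (rbTerms u v))       ≈⟨ r^-cong (a ℕ.+ b) (P-evalΣ-rbTerms u v) ⟩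
        r^ a ℕ.+ b ∙ (P (eval u) · P (eval v))     ≈⟨ r^-·-r^ a b (P (eval u)) (P (eval v)) ⟨
        (r^ a ∙ P (eval u)) · (r^ b ∙ P (eval v))  ∎
        where open SetoidReasoning ≈ᴹ-setoid

      evalΣ-prod-P : ∀ u v → evalΣ (prod-P u v) ≈ᴹ eval u · P (eval v)
      evalΣ-prod-P (end l) v = begin
        evalΣ [ suc l ◂ v ]              ≈⟨ evalΣ-[ suc l ◂ v ] ⟩
        r^ suc l ∙ P (eval v)            ≡⟨ r^-suc l (P (eval v)) ⟩
        r^ l ∙ (r · P (eval v))          ≈⟨ r^-·ˡ l r (P (eval v)) ⟨
        (r^ l ∙ r) · P (eval v)          ∎
        where open SetoidReasoning ≈ᴹ-setoid
      evalΣ-prod-P (a ◂ u) v = begin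
        evalΣ (map (a ◂_) (rbTerms u v))       ≈⟨ evalΣ-map-◂ a (rbTerms u v) ⟩
        r^ a ∙ P (evalΣ (rbTerms u v))         ≈⟨ r^-cong a (P-evalΣ-rbTerms u v) ⟩
        r^ a ∙ (P (eval u) · P (eval v))       ≈⟨ r^-·ˡ a (P (eval u)) (P (eval v)) ⟨
        (r^ a ∙ P (eval u)) · P (eval v)       ∎
        where open SetoidReasoning ≈ᴹ-setoid

      evalΣ-P-prod : ∀ u v → evalΣ (P-prod u v) ≈ᴹ P (eval u) · eval v
      evalΣ-P-prod u (end m) = begin
        evalΣ [ suc m ◂ u ]              ≈⟨ evalΣ-[ suc m ◂ u ] ⟩
        r^ suc m ∙ P (eval u)            ≡⟨ r^-suc m (P (eval u)) ⟩
        r^ m ∙ (r · P (eval u))          ≈⟨ r^-cong m (·-comm r (P (eval u))) ⟩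
        r^ m ∙ (P (eval u) · r)          ≈⟨ r^-·ʳ m (P (eval u)) r ⟨
        P (eval u) · (r^ m ∙ r)          ∎
        where open SetoidReasoning ≈ᴹ-setoid
      evalΣ-P-prod u (b ◂ v) = begin
        evalΣ (map (b ◂_) (rbTerms u v))       ≈⟨ evalΣ-map-◂ b (rbTerms u v) ⟩
        r^ b ∙ P (evalΣ (rbTerms u v))         ≈⟨ r^-cong b (P-evalΣ-rbTerms u v) ⟩
        r^ b ∙ (P (eval u) · P (eval v))       ≈⟨ r^-·ʳ b (P (eval u)) (P (eval v)) ⟨
        P (eval u) · (r^ b ∙ P (eval v))       ∎
        where open SetoidReasoning ≈ᴹ-setoid

      P-evalΣ-rbTerms : ∀ u v → P (evalΣ (rbTerms u v)) ≈ᴹ P (eval u) · P (eval v)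
      P-evalΣ-rbTerms u v = begin
        P (evalΣ ((prod-P u v ++ P-prod u v) ++ prod u v))
          ≈⟨ P-cong (≈ᴹ-trans (evalΣ-++ (prod-P u v ++ P-prod u v) (prod u v))
                              (+ᴹ-congʳ (evalΣ-++ (prod-P u v) (P-prod u v)))) ⟩
        P (evalΣ (prod-P u v) +ᴹ evalΣ (P-prod u v) +ᴹ evalΣ (prod u v))
          ≈⟨ ≈ᴹ-trans (P-+ _ _) (+ᴹ-congʳ (P-+ _ _)) ⟩
        P (evalΣ (prod-P u v)) +ᴹ P (evalΣ (P-prod u v)) +ᴹ P (evalΣ (prod u v))
          ≈⟨ +ᴹ-cong (+ᴹ-cong (P-cong (evalΣ-prod-P u v)) (P-cong (evalΣ-P-prod u v)))
                     (P-cong (evalΣ-prod u v)) ⟩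
        P (eval u · P (eval v)) +ᴹ P (P (eval u) · eval v) +ᴹ P (eval u · eval v)
          ≈⟨ P-RB (eval u) (eval v) ⟨
        P (eval u) · P (eval v) ∎
        where open SetoidReasoning ≈ᴹ-setoid

    open Independence module′ eval

    extend-map-, : ∀ a ws → extend (map (a ,_) ws) ≈ᴹ a *ₗ evalΣ ws
    extend-map-, a []       = ≈ᴹ-sym (*ₗ-zeroʳ a)
    extend-map-, a (w ∷ ws) = ≈ᴹ-trans (+ᴹ-congˡ (extend-map-, a ws)) (≈ᴹ-sym (*ₗ-distribˡ a _ _))

    *ₗ-·-*ₗ : ∀ a b x y → (a *ₗ x) · (b *ₗ y) ≈ᴹ (a * b) *ₗ (x · y)
    *ₗ-·-*ₗ a b x y =
      ≈ᴹ-trans (*ₗ-· a x (b *ₗ y))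
               (≈ᴹ-trans (*ₗ-congˡ (·-*ₗ b x y)) (≈ᴹ-sym (*ₗ-assoc a b (x · y))))

    extend-prodᶜ : ∀ a u b v → extend (prodᶜ (a , u) (b , v)) ≈ᴹ (a *ₗ eval u) · (b *ₗ eval v)
    extend-prodᶜ a u b v = begin
      extend (map (a * b ,_) (prod u v))   ≈⟨ extend-map-, (a * b) (prod u v) ⟩
      (a * b) *ₗ evalΣ (prod u v)          ≈⟨ *ₗ-congˡ (evalΣ-prod u v) ⟩
      (a * b) *ₗ (eval u · eval v)         ≈⟨ *ₗ-·-*ₗ a b (eval u) (eval v) ⟨
      (a *ₗ eval u) · (b *ₗ eval v)        ∎
      where open SetoidReasoning ≈ᴹ-setoid

    extend-*ᶜ : ∀ G H → extend (G *ᶜ H) ≈ᴹ extend G · extend H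
    extend-*ᶜ []            H = ≈ᴹ-sym (·-zeroˡ (extend H))
    extend-*ᶜ ((a , u) ∷ G) H =
      ≈ᴹ-trans (extend-++ (concatMap (prodᶜ (a , u)) H) (G *ᶜ H))
        (≈ᴹ-trans (+ᴹ-cong (extend-prodᶜ-right H) (extend-*ᶜ G H))
                  (≈ᴹ-sym (·-distribʳ (extend H) _ _)))
      where
      extend-prodᶜ-right : ∀ H → extend (concatMap (prodᶜ (a , u)) H) ≈ᴹ (a *ₗ eval u) · extend H
      extend-prodᶜ-right []            = ≈ᴹ-sym (·-zeroʳ (a *ₗ eval u))
      extend-prodᶜ-right ((b , v) ∷ H) =
        ≈ᴹ-trans (extend-++ (prodᶜ (a , u) (b , v)) (concatMap (prodᶜ (a , u)) H))
          (≈ᴹ-trans (+ᴹ-cong (extend-prodᶜ a u b v) (extend-prodᶜ-right H))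
                    (≈ᴹ-sym (·-distribˡ (a *ₗ eval u) _ _)))

    extend-Pᶜ : ∀ G → extend (Pᶜ G) ≈ᴹ P (extend G)
    extend-Pᶜ []            = ≈ᴹ-sym P-zero
    extend-Pᶜ ((a , w) ∷ G) =
      ≈ᴹ-trans (+ᴹ-cong (≈ᴹ-sym (P-*ₗ a (eval w))) (extend-Pᶜ G)) (≈ᴹ-sym (P-+ _ _))

    extend-combination-⟦⟧ : ∀ G → extend (combination (⟦⟧-inSpan G)) ≈ᴹ extend G
    extend-combination-⟦⟧ []            = ≈ᴹ-refl
    extend-combination-⟦⟧ ((a , w) ∷ G) =
      +ᴹ-cong (*ₗ-cong (*-identityʳ a) (≈ᴹ-reflexive (≡.cong eval (fromIdx-toIdx w))))
              (extend-combination-⟦⟧ G)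

    h : Sub k → Carrierᴹ
    h (_ , p) = extend (combination p)

    h-isRBHom : IsRBHom k mulClosed PQ R h
    h-isRBHom = h-cong , h-+ , h-⊙ , h-⊗ , h-P
      where
      h-cong : ∀ x y → _≈S_ k x y → h x ≈ᴹ h y
      h-cong (f , p) (g , q) f≈g =
        extend-cong (combination p) (combination q)
          (≈ˢ-trans (⟦combination⟧ p) (≈ˢ-trans f≈g (≈ˢ-sym (⟦combination⟧ q))))
      h-+ : ∀ x y → h (_⊕_ k x y) ≈ᴹ h x +ᴹ h y
      h-+ (_ , p) (_ , q) = extend-++ (combination p) (combination q)
      h-⊙ : ∀ a x → h (_⊙_ k a x) ≈ᴹ a *ₗ h x
      h-⊙ a (_ , p) = extend-·ᶜ a (combination p)
      h-⊗ : ∀ x y → h (_⊗_ k mulClosed x y) ≈ᴹ h x · h y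
      h-⊗ (_ , p) (_ , q) =
        ≈ᴹ-trans (extend-combination-⟦⟧ (combination p *ᶜ combination q))
                 (extend-*ᶜ (combination p) (combination q))
      h-P : ∀ x → h (PQ x) ≈ᴹ P (h x)
      h-P (_ , p) = ≈ᴹ-trans (extend-combination-⟦⟧ (Pᶜ (combination p))) (extend-Pᶜ (combination p))

    h-generator : h generator ≈ᴹ r
    h-generator = ≈ᴹ-trans (+ᴹ-identityʳ _) (*ₗ-identityˡ r)

    unique : ∀ h′ → IsRBHom k mulClosed PQ R h′ → h′ generator ≈ᴹ r → ∀ x → h′ x ≈ᴹ h x
    unique h′ (h′-cong , h′-+ , h′-⊙ , h′-⊗ , h′-P) h′-generator (_ , p) = agree p
      where
      h′-x₀· : ∀ w → h′ (basisᵢ w) ≈ᴹ eval w → h′ (basisᵢ (x₀· w)) ≈ᴹ r · eval w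
      h′-x₀· w h′w≈ =
        ≈ᴹ-trans (h′-cong (basisᵢ (x₀· w)) (_⊗_ k mulClosed generator (basisᵢ w)) (M-x₀· w))
                 (≈ᴹ-trans (h′-⊗ generator (basisᵢ w)) (·-cong h′-generator h′w≈))

      h′-basis : ∀ w → h′ (basisᵢ w) ≈ᴹ eval w
      h′-basis (end zero)    = h′-generator
      h′-basis (end (suc l)) = h′-x₀· (end l) (h′-basis (end l))
      h′-basis (zero ◂ w)    =
        ≈ᴹ-trans (h′-cong (basisᵢ (0 ◂ w)) (PQ (basisᵢ w)) (≈ˢ-sym (Pˢ-M w)))
                 (≈ᴹ-trans (h′-P (basisᵢ w)) (P-cong (h′-basis w)))
      h′-basis (suc a ◂ w)   = h′-x₀· (a ◂ w) (h′-basis (a ◂ w))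

      agree : ∀ {f} (p : InSpan k f) → h′ (f , p) ≈ᴹ extend (combination p)
      agree (basis α) =
        ≈ᴹ-trans (h′-cong (Mbar k α , basis α) (basisᵢ (fromIdx α)) (≈ˢ-sym (M-fromIdx α)))
          (≈ᴹ-trans (h′-basis (fromIdx α)) (≈ᴹ-sym (≈ᴹ-trans (+ᴹ-identityʳ _) (*ₗ-identityˡ _))))
      agree zer =
        ≈ᴹ-trans (h′-cong (0ˢ , zer) (_⊙_ k 0# (0ˢ , zer)) (λ β → ≈-sym (zeroˡ 0#)))
                 (≈ᴹ-trans (h′-⊙ 0# (0ˢ , zer)) (*ₗ-zeroˡ _))
      agree (add {f} {g} p q) =
        ≈ᴹ-trans (h′-+ (f , p) (g , q))
                 (≈ᴹ-trans (+ᴹ-cong (agree p) (agree q))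
                           (≈ᴹ-sym (extend-++ (combination p) (combination q))))
      agree (scale a {f} p) =
        ≈ᴹ-trans (h′-⊙ a (f , p))
                 (≈ᴹ-trans (*ₗ-congˡ (agree p)) (≈ᴹ-sym (extend-·ᶜ a (combination p))))
      agree (resp {f} {g} f≈g p) = ≈ᴹ-trans (h′-cong (g , resp f≈g p) (f , p) (≈ˢ-sym f≈g)) (agree p)

theorem3p9 : ∀ {c ℓ : Level} (k : CommutativeRing c ℓ) → Theorem3p9 k
theorem3p9 k = record
  { mul-closed = mulClosed
  ; PQ         = PQ
  ; PQ-linear  = PQ-linear
  ; PQ-basis   = PQ-basis
  ; PQ-RB      = PQ-rotaBaxter
  ; generator  = generator
  ; free       = λ _ _ R r → let open Universal R r in h , h-isRBHom , h-generator , unique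
  }
  where open LWCQSym k
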